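{- Let $0 < \delta \leq \Delta$ be integers and let $G$ be a graph with minimum degree $\delta$ and maximum degree $\Delta$ which is minimal for $\delta$ and $\Delta$. Then $$\frac{\Delta(\delta+1)}{2} \leq |E(G)| \leq \Delta\delta \quad \text{if } \Delta(\delta+1) \text{ is even},$$ $$\frac{\Delta(\delta+1)+1}{2} \leq |E(G)| \leq \Delta\delta \quad \text{if } \Delta(\delta+1) \text{ is odd},$$ $$\Delta + 1 \leq |V(G)| \leq \frac{\Delta(2\delta-1)}{\delta} + 1.$$ For $|E(G)|$, the lower bound is attained if and only if $G \in \mathcal{G}_{\delta,\Delta}$, and the upper bound is attained if and only if $G = K_{\delta,\Delta}$.
   Context: All graphs are finite, simple (no loops or multiple edges) and have at least one edge. For a vertex $u$, $d_u$ denotes its degree. The geometric-arithmetic index of $G$ is $GA_1(G) = \sum_{uv \in E(G)} \frac{2\sqrt{d_u d_v}}{d_u + d_v}$. A graph $G$ with minimum degree $\delta$ and maximum degree $\Delta$ is called minimal (for $\delta$ and $\Delta$) if $GA_1(G) \leq GA_1(\Gamma)$ for every graph $\Gamma$ with minimum degree $\delta$ and maximum degree $\Delta$. $K_{\delta,\Delta}$ is the complete bipartite graph with parts of sizes $\delta$ and $\Delta$. For integers $0 < \delta \leq \Delta$, $\mathcal{G}_{\delta,\Delta}$ denotes the set of graphs $G$ with minimum degree $\delta$ and maximum degree $\Delta$ such that: (1) if $\delta = \Delta$, $G$ is isomorphic to the complete graph $K_{\Delta+1}$; (2) if $\delta < \Delta$ and $\Delta(\delta+1)$ is even, $|V(G)|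 = \Delta + 1$ and there are $\Delta$ vertices of degree $\delta$; (3) if $\delta < \Delta - 1$ and $\Delta(\delta+1)$ is odd, $|V(G)| = \Delta+1$, there are $\Delta - 1$ vertices of degree $\delta$ and one vertex of degree $\delta+1$; (4) if $\delta = \Delta - 1$ and $\Delta$ is odd, $|V(G)| = \Delta + 1$, there are $\Delta - 1$ vertices of degree $\delta$ and two vertices of degree $\Delta$. -}

module Defs where

open import Data.Bool using (Bool; true; false; if_then_else_; _∧_; _∨_; not)
open import Data.Bool.Properties using (∨-comm)
open import Data.Nat using (ℕ; zero; suc; _+_; _*_; _∸_; _^_; _≤_; _<_; _≤ᵇ_; _<ᵇ_; _≡ᵇ_; _%_)
open import Data.Nat.Properties using (m*n≢0; m^n≢0)
open import Data.Fin using (Fin; toℕ; _≟_)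
import Data.Fin as F
open import Data.Integer using (+_)
open import Data.Rational.Unnormalised as Q using (ℚᵘ; 0ℚᵘ)
open import Data.Product using (Σ; ∃; _×_; _,_)
open import Data.Sum using (_⊎_)
open import Relation.Binary.PropositionalEquality using (_≡_; refl)
open import Relation.Nullary using (yes; no)
open import Relation.Nullary.Decidable using (⌊_⌋)

record Graph (n : ℕ) : Set where
  field
    adj   : Fin n → Fin n → Bool
    sym   : ∀ i j → adj i j ≡ adj j i
    irref : ∀ i → adj i i ≡ false
open Graph public

count : ∀ {n} → (Fin n → Bool) → ℕ
count {zero}  p = 0
count {suc n} p = (if p F.zero then 1 else 0) + count (λ k → p (F.suc k))

sumℕ : ∀ {n} → (Fin n → ℕ) → ℕ
sumℕ {zero}  f = 0
sumℕ {suc n} f = f F.zero + sumℕ (λ k → f (F.suc k))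

sumQ : ∀ {n} → (Fin n → ℚᵘ) → ℚᵘ
sumQ {zero}  f = 0ℚᵘ
sumQ {suc n} f = f F.zero Q.+ sumQ (λ k → f (F.suc k))

deg : ∀ {n} → Graph n → Fin n → ℕ
deg G i = count (adj G i)

-- each edge uv is the unordered pair {i,j} with toℕ i < toℕ j
isEdge : ∀ {n} → Graph n → Fin n → Fin n → Bool
isEdge G i j = (toℕ i <ᵇ toℕ j) ∧ adj G i j

numEdges : ∀ {n} → Graph n → ℕ
numEdges G = sumℕ (λ i → count (isEdge G i))

MinDeg : ∀ {n} → Graph n → ℕ → Set
MinDeg G δ = (∀ i → δ ≤ deg G i) × ∃ λ i → deg G i ≡ δ

MaxDeg : ∀ {n} → Graph n → ℕ → Set
MaxDeg G Δ = (∀ i → deg G i ≤ Δ) × ∃ λ i → deg G i ≡ Δ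

numDeg : ∀ {n} → Graph n → ℕ → ℕ
numDeg G d = count (λ i → deg G i ≡ᵇ d)

-- GA_1(G) = Σ_{uv ∈ E} 2√(d_u d_v)/(d_u+d_v).  There are no reals in the
-- library, so GA_1(G) is represented by its sequence of rational lower
-- approximations GAₖ(G) obtained by replacing each 2√(ab) by
-- ⌊2^k · 2√(ab)⌋ / 2^k = isqrt(4^(k+1)·a·b) / 2^k.  Each term then
-- satisfies  approx ≤ exact < approx + 1/2^k, hence
--   GAₖ(G) ≤ GA_1(G) < GAₖ(G) + |E(G)|/2^k,
-- and GA_1(G) ≤ GA_1(Γ) holds iff ∀ k, GAₖ(G) ≤ GAₖ(Γ) + |E(Γ)|/2^k.

isqrt : ℕ → ℕ
isqrt zero    = zero
isqrt (suc m) with isqrt m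
... | r = if suc r * suc r ≤ᵇ suc m then suc r else r

gaTermApprox : ℕ → ℕ → ℕ → ℚᵘ
gaTermApprox k a b with a + b
... | zero  = 0ℚᵘ
... | suc s = Q._/_ (+ isqrt (4 ^ suc k * a * b)) (suc s * 2 ^ k)
                {{m*n≢0 (suc s) (2 ^ k) {{_}} {{m^n≢0 2 k}}}}

GAapprox : ∀ {n} → ℕ → Graph n → ℚᵘ
GAapprox k G = sumQ (λ i → sumQ (λ j →
  if isEdge G i j then gaTermApprox k (deg G i) (deg G j) else 0ℚᵘ))

GA≤ : ∀ {n m} → Graph n → Graph m → Set
GA≤ G Γ = ∀ k → GAapprox k G Q.≤
  (GAapprox k Γ Q.+ Q._/_ (+ numEdges Γ) (2 ^ k) {{m^n≢0 2 k}})

Minimal : ∀ {n} → ℕ → ℕ → Graph n → Set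
Minimal δ Δ G = ∀ m (Γ : Graph m) → 0 < numEdges Γ →
  MinDeg Γ δ → MaxDeg Γ Δ → GA≤ G Γ

record Iso {n m : ℕ} (G : Graph n) (H : Graph m) : Set where
  field
    to      : Fin n → Fin m
    from    : Fin m → Fin n
    from∘to : ∀ i → from (to i) ≡ i
    to∘from : ∀ j → to (from j) ≡ j
    adj-pres : ∀ i j → adj H (to i) (to j) ≡ adj G i j

K : (m : ℕ) → Graph m
K m = record { adj = λ i j → not ⌊ i ≟ j ⌋ ; sym = s ; irref = ir }
  where
    s : ∀ i j → not ⌊ i ≟ j ⌋ ≡ not ⌊ j ≟ i ⌋
    s i j with i ≟ j | j ≟ i
    ... | yes _ | yes _ = refl
    ... | no _  | no _  = refl
    ... | yes refl | no ne = Data.Empty.⊥-elim (ne refl)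
      where import Data.Empty
    ... | no ne | yes refl = Data.Empty.⊥-elim (ne refl)
      where import Data.Empty
    ir : ∀ i → not ⌊ i ≟ i ⌋ ≡ false
    ir i with i ≟ i
    ... | yes _ = refl
    ... | no ne = Data.Empty.⊥-elim (ne refl)
      where import Data.Empty

crosses : ℕ → ℕ → ℕ → Bool
crosses a x y = (x <ᵇ a) ∧ not (y <ᵇ a)

private
  crosses-irr : ∀ a x → crosses a x x ≡ false
  crosses-irr zero    x       = refl
  crosses-irr (suc a) zero    = refl
  crosses-irr (suc a) (suc x) = crosses-irr a x

Kbip : (a b : ℕ) → Graph (a + b)
Kbip a b = record
  { adj   = λ i j → crosses a (toℕ i) (toℕ j) ∨ crosses a (toℕ j) (toℕ i)
  ; sym   = λ i j → ∨-comm (crosses a (toℕ i) (toℕ j)) (crosses a (toℕ j) (toℕ i))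
  ; irref = λ i → irr (toℕ i)
  }
  where
    irr : ∀ x → crosses a x x ∨ crosses a x x ≡ false
    irr x rewrite crosses-irr a x = refl

InGfamily : ∀ {n} → ℕ → ℕ → Graph n → Set
InGfamily {n} δ Δ G =
    (δ ≡ Δ × Iso G (K (suc Δ)))
  ⊎ (δ < Δ × Δ * (δ + 1) % 2 ≡ 0 × n ≡ suc Δ × numDeg G δ ≡ Δ)
  ⊎ (suc δ < Δ × Δ * (δ + 1) % 2 ≡ 1 × n ≡ suc Δ
       × numDeg G δ ≡ Δ ∸ 1 × numDeg G (suc δ) ≡ 1)
  ⊎ (suc δ ≡ Δ × Δ % 2 ≡ 1 × n ≡ suc Δ
       × numDeg G δ ≡ Δ ∸ 1 × numDeg G Δ ≡ 2)

-- All degrees are at least δ; let v be a vertex of degree Δ. Then 2|E| = Δ + Σ_{u ≠ v} d_u is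
-- at least Δ + (n - 1)δ and n ≥ Δ + 1, so 2|E| ≥ Δ(δ + 1). Equality, or equality up to the parity
-- correction +1, forces n = Δ + 1 and all degrees other than d_v to equal δ (respectively: all but
-- one, which is δ + 1); this is membership in 𝒢_{δ,Δ}.
--
-- For the upper bound, the GA term 2√(ab)/(a+b) of an edge with end degrees a, b ∈ [δ, Δ] is at
-- least its value at (δ, Δ), since ab(δ+Δ)² - δΔ(a+b)² = (aΔ - bδ)(bΔ - aδ) ≥ 0, with equality
-- only for {a, b} = {δ, Δ}. So GA₁(G) ≥ |E(G)|·GA₁(K_{δ,Δ})/(δΔ), and minimality gives
-- |E(G)| ≤ δΔ; at equality every edge joins a vertex of degree δ to one of degree Δ, which forces
-- G ≅ K_{δ,Δ} (when δ = Δ, comparing with K_{Δ+1} forces Δ = 1). GA₁ is only accessible through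
-- its dyadic lower approximations, so these inequalities are run at one precision fine enough
-- that the rounding errors are smaller than the gap produced by a non-extremal edge.
-- The vertex bound combines both: Δ + (n - 1)δ ≤ 2|E| ≤ 2Δδ.

module Submission where

open import Defs
open import Data.Nat using (ℕ; suc; _+_; _*_; _∸_; _≤_; _<_; _%_)
open import Data.Product using (_×_)
open import Function.Bundles using (_⇔_)
open import Relation.Binary.PropositionalEquality using (_≡_)

import Algebra.Properties.Semiring.Sum
open import Data.Bool using (Bool; true; false; if_then_else_; not; _∧_; _∨_; T)
open import Data.Bool.Properties using (∧-zeroʳ; ∧-identityʳ; ∨-identityʳ; ∧-conicalʳ; not-¬)
open import Data.Empty using (⊥-elim)
open import Data.Fin using (Fin; zero; suc; toℕ; fromℕ<; punchIn; _≟_; _↑ˡ_; _↑ʳ_; join; splitAt)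
open import Data.Fin.Permutation using (permutation; ↔⇒≡)
open import Data.Fin.Properties
  using (punchInᵢ≢i; punchIn-punchOut; toℕ-injective; toℕ-↑ˡ; toℕ-↑ʳ; toℕ<n; splitAt-join; join-splitAt)
import Data.Integer as ℤ
import Data.Integer.Properties as ℤₚ
import Data.Integer.Tactic.RingSolver as ℤ-Solver
open import Data.Nat
  using (zero; pred; NonZero; >-nonZero; z≤n; s≤s; s≤s⁻¹; z<s; _^_; _≤ᵇ_; _<ᵇ_; _≡ᵇ_; _<?_)
open import Data.Nat.DivMod using (m*n%n≡0; m%n<n; %-distribˡ-*; [m+kn]%n≡m%n)
open import Data.Nat.Properties hiding (_≟_)
import Data.Nat.Properties as ℕ
open import Data.Nat.Tactic.RingSolver using (solve-∀)
open import Algebra.Properties.CommutativeSemigroup ℕ.+-commutativeSemigroup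
  using () renaming (x∙yz≈y∙xz to x+[y+z]≡y+[x+z])
open import Data.Product using (∃; ∃₂; _,_; proj₁; proj₂; swap)
open import Data.Rational.Unnormalised as Q using (ℚᵘ; mkℚᵘ; 0ℚᵘ)
import Data.Rational.Unnormalised.Properties as Qₚ
open import Data.Sum using (_⊎_; inj₁; inj₂; [_,_]′; map₁; map₂)
open import Function.Base using (_∘_)
open import Function.Bundles using (mk⇔; Equivalence)
open import Relation.Binary using (tri<; tri≈; tri>)
open import Relation.Binary.PropositionalEquality
  using (refl; trans; cong; cong₂; subst; subst₂; _≢_; module ≡-Reasoning)
import Relation.Binary.PropositionalEquality as ≡
open import Relation.Nullary using (¬_; yes; no; Dec; does; _×-dec_; _⊎-dec_)
open import Relation.Nullary.Decidable using (⌊_⌋; dec-true; dec-false; isYes≗does)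

-- Finite sums and counts over Fin n

𝟙 : Bool → ℕ
𝟙 b = if b then 1 else 0

module ∑ℕ = Algebra.Properties.Semiring.Sum +-*-semiring

sumℕ≡∑ : ∀ {n} (f : Fin n → ℕ) → sumℕ f ≡ ∑ℕ.sum f
sumℕ≡∑ {zero}  f = refl
sumℕ≡∑ {suc n} f = cong (f zero +_) (sumℕ≡∑ (λ i → f (suc i)))

sum-cong : ∀ {n} {f g : Fin n → ℕ} → (∀ i → f i ≡ g i) → sumℕ f ≡ sumℕ g
sum-cong {zero}  f≗g = refl
sum-cong {suc n} f≗g = cong₂ _+_ (f≗g zero) (sum-cong (λ i → f≗g (suc i)))

sum-+ : ∀ {n} (f g : Fin n → ℕ) → sumℕ (λ i → f i + g i) ≡ sumℕ f + sumℕ g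
sum-+ f g = begin
  sumℕ (λ i → f i + g i)         ≡⟨ sumℕ≡∑ (λ i → f i + g i) ⟩
  ∑ℕ.sum (λ i → f i + g i)       ≡⟨ ∑ℕ.∑-distrib-+ f g ⟩
  ∑ℕ.sum f + ∑ℕ.sum g            ≡⟨ cong₂ _+_ (sumℕ≡∑ f) (sumℕ≡∑ g) ⟨
  sumℕ f + sumℕ g                ∎
  where open ≡-Reasoning

sum-const : ∀ {n} c → sumℕ {n} (λ _ → c) ≡ n * c
sum-const {zero}  c = refl
sum-const {suc n} c = cong (c +_) (sum-const {n} c)

sum-*ʳ : ∀ {n} (f : Fin n → ℕ) c → sumℕ (λ i → f i * c) ≡ sumℕ f * c
sum-*ʳ {zero}  f c = refl
sum-*ʳ {suc n} f c = trans (cong (f zero * c +_) (sum-*ʳ (λ i → f (suc i)) c))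
                           (≡.sym (*-distribʳ-+ c (f zero) _))

sum-comm : ∀ {m n} (f : Fin m → Fin n → ℕ) →
           sumℕ (λ i → sumℕ (f i)) ≡ sumℕ (λ j → sumℕ (λ i → f i j))
sum-comm {zero}  {n} f = ≡.sym (trans (sum-const {n} 0) (*-zeroʳ n))
sum-comm {suc m} f = trans (cong (sumℕ (f zero) +_) (sum-comm (λ i → f (suc i))))
                           (≡.sym (sum-+ (f zero) _))

sum-mono : ∀ {n} {f g : Fin n → ℕ} → (∀ i → f i ≤ g i) → sumℕ f ≤ sumℕ g
sum-mono {zero}  f≤g = z≤n
sum-mono {suc n} f≤g = +-mono-≤ (f≤g zero) (sum-mono (λ i → f≤g (suc i)))

term≤sum : ∀ {n} (f : Fin n → ℕ) i → f i ≤ sumℕ f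
term≤sum f zero    = m≤m+n _ _
term≤sum f (suc i) = ≤-trans (term≤sum (λ k → f (suc k)) i) (m≤n+m _ _)

sum-remove : ∀ {m} (f : Fin (suc m) → ℕ) v → sumℕ f ≡ f v + sumℕ (λ j → f (punchIn v j))
sum-remove f v = begin
  sumℕ f                                  ≡⟨ sumℕ≡∑ f ⟩
  ∑ℕ.sum f                                ≡⟨ ∑ℕ.sum-remove {i = v} f ⟩
  f v + ∑ℕ.sum (λ j → f (punchIn v j))    ≡⟨ cong (f v +_) (sumℕ≡∑ (λ j → f (punchIn v j))) ⟨
  f v + sumℕ (λ j → f (punchIn v j))      ∎
  where open ≡-Reasoning

+-squeeze : ∀ {a b x y} → a ≤ x → b ≤ y → x + y ≤ a + b → x ≡ a × y ≡ b
+-squeeze {a} {b} {x} {y} a≤x b≤y x+y≤a+b with m≤n⇒m<n∨m≡n a≤x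
... | inj₂ refl = refl , ≤-antisym (+-cancelˡ-≤ a y b x+y≤a+b) b≤y
... | inj₁ a<x  = ⊥-elim (<⇒≱ (+-mono-<-≤ a<x b≤y) x+y≤a+b)

sum-squeeze : ∀ {n} {f g : Fin n → ℕ} → (∀ i → f i ≤ g i) → sumℕ g ≤ sumℕ f → ∀ i → f i ≡ g i
sum-squeeze {suc n} {f} {g} f≤g Σg≤Σf = squeezed
  where
  head&tail : g zero ≡ f zero × sumℕ (λ k → g (suc k)) ≡ sumℕ (λ k → f (suc k))
  head&tail = +-squeeze (f≤g zero) (sum-mono (λ k → f≤g (suc k))) Σg≤Σf
  squeezed : ∀ i → f i ≡ g i
  squeezed zero    = ≡.sym (proj₁ head&tail)
  squeezed (suc i) = sum-squeeze (λ k → f≤g (suc k)) (≤-reflexive (proj₂ head&tail)) i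

count≡sum𝟙 : ∀ {n} (p : Fin n → Bool) → count p ≡ sumℕ (λ i → 𝟙 (p i))
count≡sum𝟙 {zero}  p = refl
count≡sum𝟙 {suc n} p = cong (𝟙 (p zero) +_) (count≡sum𝟙 (λ i → p (suc i)))

count-cong : ∀ {n} {p q : Fin n → Bool} → (∀ i → p i ≡ q i) → count p ≡ count q
count-cong {p = p} {q} p≗q =
  trans (count≡sum𝟙 p) (trans (sum-cong (λ i → cong 𝟙 (p≗q i))) (≡.sym (count≡sum𝟙 q)))

count-remove : ∀ {m} (p : Fin (suc m) → Bool) v → count p ≡ 𝟙 (p v) + count (λ j → p (punchIn v j))
count-remove p v = trans (count≡sum𝟙 p) (trans (sum-remove (λ i → 𝟙 (p i)) v)
                     (cong (𝟙 (p v) +_) (≡.sym (count≡sum𝟙 (λ j → p (punchIn v j))))))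

count-remove-false : ∀ {m} (p : Fin (suc m) → Bool) v → p v ≡ false → count p ≡ count (λ j → p (punchIn v j))
count-remove-false p v pv = trans (count-remove p v) (cong (λ b → 𝟙 b + count (λ j → p (punchIn v j))) pv)

count-compl : ∀ {n} (p : Fin n → Bool) → count p + count (λ i → not (p i)) ≡ n
count-compl {zero}  p = refl
count-compl {suc n} p with p zero
... | true  = cong suc (count-compl (λ i → p (suc i)))
... | false = trans (+-suc (count (λ i → p (suc i))) _) (cong suc (count-compl (λ i → p (suc i))))

count≤n : ∀ {n} (p : Fin n → Bool) → count p ≤ n
count≤n p = subst (count p ≤_) (count-compl p) (m≤m+n _ _)

𝟙-mono : ∀ {a b} → (a ≡ true → b ≡ true) → 𝟙 a ≤ 𝟙 b
𝟙-mono {false} a⇒b = z≤n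
𝟙-mono {true}  a⇒b rewrite a⇒b refl = ≤-refl

count-mono : ∀ {n} {p q : Fin n → Bool} → (∀ i → p i ≡ true → q i ≡ true) → count p ≤ count q
count-mono {p = p} {q} p⊆q = subst₂ _≤_ (≡.sym (count≡sum𝟙 p)) (≡.sym (count≡sum𝟙 q))
                                        (sum-mono (λ i → 𝟙-mono (p⊆q i)))

count-squeeze : ∀ {n} {p q : Fin n → Bool} → (∀ i → p i ≡ true → q i ≡ true) →
                count q ≤ count p → ∀ i → q i ≡ true → p i ≡ true
count-squeeze {p = p} {q} p⊆q #q≤#p i qi = 𝟙≡1 (trans 𝟙pi≡𝟙qi (cong 𝟙 qi))
  where
  𝟙pi≡𝟙qi : 𝟙 (p i) ≡ 𝟙 (q i)
  𝟙pi≡𝟙qi = sum-squeeze (λ k → 𝟙-mono (p⊆q k))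
              (subst₂ _≤_ (count≡sum𝟙 q) (count≡sum𝟙 p) #q≤#p) i
  𝟙≡1 : ∀ {b} → 𝟙 b ≡ 1 → b ≡ true
  𝟙≡1 {true} _ = refl

count-all : ∀ {n} {p : Fin n → Bool} → (∀ i → p i ≡ true) → count p ≡ n
count-all {zero}  all = refl
count-all {suc n} {p} all rewrite all zero = cong suc (count-all (λ i → all (suc i)))

count≡n⇒all : ∀ {n} {p : Fin n → Bool} → count p ≡ n → ∀ i → p i ≡ true
count≡n⇒all {n} {p} #p≡n i = count-squeeze {p = p} {q = λ _ → true} (λ _ _ → refl)
  (≤-reflexive (trans (count-all {p = λ _ → true} (λ _ → refl)) (≡.sym #p≡n))) i refl

count-none : ∀ {n} {p : Fin n → Bool} → (∀ i → p i ≡ false) → count p ≡ 0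
count-none {zero}  none = refl
count-none {suc n} {p} none rewrite none zero = count-none (λ i → none (suc i))

count-witness : ∀ {n} (p : Fin n → Bool) → 0 < count p → ∃ λ i → p i ≡ true
count-witness {suc n} p 0<#p with p zero in p0
... | true  = zero , p0
... | false = let (i , pi) = count-witness (λ k → p (suc k)) 0<#p in suc i , pi

sum-if : ∀ {n} (p : Fin n → Bool) x y →
         sumℕ (λ i → if p i then x else y) ≡ count p * x + count (λ i → not (p i)) * y
sum-if {zero}  p x y = refl
sum-if {suc n} p x y with p zero
... | true  = trans (cong (x +_) (sum-if (λ i → p (suc i)) x y)) (≡.sym (+-assoc x _ _))
... | false = trans (cong (y +_) (sum-if (λ i → p (suc i)) x y)) (x+[y+z]≡y+[x+z] y (count (λ i → p (suc i)) * x) _)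

∀-punchIn⇒∀-≢ : ∀ {m} {P : Fin (suc m) → Set} v → (∀ j → P (punchIn v j)) → ∀ i → i ≢ v → P i
∀-punchIn⇒∀-≢ {P = P} v P-rest i i≢v = subst P (punchIn-punchOut (i≢v ∘ ≡.sym)) (P-rest _)

≡ᵇ-true : ∀ {m n} → m ≡ n → (m ≡ᵇ n) ≡ true
≡ᵇ-true {m} {n} = dec-true (m ℕ.≟ n)

≡ᵇ-false : ∀ {m n} → m ≢ n → (m ≡ᵇ n) ≡ false
≡ᵇ-false {m} {n} = dec-false (m ℕ.≟ n)

≡ᵇ-true⁻ : ∀ {m n} → (m ≡ᵇ n) ≡ true → m ≡ n
≡ᵇ-true⁻ {m} {n} e = ≡ᵇ⇒≡ m n (subst T (≡.sym e) _)

<ᵇ-true : ∀ {m n} → m < n → (m <ᵇ n) ≡ true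
<ᵇ-true {m} {n} = dec-true (m <? n)

<ᵇ-false : ∀ {m n} → ¬ m < n → (m <ᵇ n) ≡ false
<ᵇ-false {m} {n} = dec-false (m <? n)

module _ {m : ℕ} {r : Fin m → ℕ} {c : ℕ} where

  sum≡*⇒const : (∀ j → c ≤ r j) → sumℕ r ≡ m * c → ∀ j → r j ≡ c
  sum≡*⇒const c≤r Σr≡mc j =
    ≡.sym (sum-squeeze c≤r (≤-reflexive (trans Σr≡mc (≡.sym (sum-const {m} c)))) j)

  const⇒sum≡* : (∀ j → r j ≡ c) → sumℕ r ≡ m * c
  const⇒sum≡* r≡c = trans (sum-cong r≡c) (sum-const {m} c)

  count≡⇒const : count (λ j → r j ≡ᵇ c) ≡ m → ∀ j → r j ≡ c
  count≡⇒const #≡m j = ≡ᵇ-true⁻ (count≡n⇒all #≡m j)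

  const⇒count≡ : (∀ j → r j ≡ c) → count (λ j → r j ≡ᵇ c) ≡ m
  const⇒count≡ r≡c = count-all (λ j → ≡ᵇ-true (r≡c j))

exceeds-somewhere : ∀ {m c} (r : Fin m → ℕ) → m * c < sumℕ r → ∃ λ w → c < r w
exceeds-somewhere {suc m} {c} r mc<Σr with c <? r zero
... | yes c<r₀ = zero , c<r₀
... | no  c≮r₀ = suc (proj₁ rest-exceeds) , proj₂ rest-exceeds
  where
  rest-large : m * c < sumℕ (λ j → r (suc j))
  rest-large = ≰⇒> (λ Σ≤mc → <⇒≱ mc<Σr (+-mono-≤ (≮⇒≥ c≮r₀) Σ≤mc))
  rest-exceeds = exceeds-somewhere (λ j → r (suc j)) rest-large

record Bump {m} (r : Fin m → ℕ) (c : ℕ) : Set where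
  field
    at    : Fin m
    r-at  : r at ≡ suc c
    r-off : ∀ j → j ≢ at → r j ≡ c

private
  suc[m]*c+1≡ : ∀ m c → suc m * c + 1 ≡ suc c + m * c
  suc[m]*c+1≡ = solve-∀

sum≡*+1⇒Bump : ∀ {m c} {r : Fin m → ℕ} → (∀ j → c ≤ r j) → sumℕ r ≡ m * c + 1 → Bump r c
sum≡*+1⇒Bump {zero}      _   ()
sum≡*+1⇒Bump {suc m} {c} {r} c≤r Σr≡ = record { at = w ; r-at = proj₁ squeezed ; r-off = ∀-punchIn⇒∀-≢ w rest≡c }
  where
  exceeds = exceeds-somewhere r (subst (suc m * c <_) (≡.sym Σr≡) (m<m+n _ z<s))
  w = proj₁ exceeds
  rest = λ j → r (punchIn w j)
  squeezed : r w ≡ suc c × sumℕ rest ≡ m * c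
  squeezed = +-squeeze (proj₂ exceeds)
               (subst (_≤ sumℕ rest) (sum-const {m} c) (sum-mono (λ j → c≤r (punchIn w j))))
               (≤-reflexive (trans (≡.sym (sum-remove r w)) (trans Σr≡ (suc[m]*c+1≡ m c))))
  rest≡c = sum≡*⇒const (λ j → c≤r (punchIn w j)) (proj₂ squeezed)

Bump⇒sum : ∀ {m c} {r : Fin m → ℕ} → Bump r c → sumℕ r ≡ m * c + 1
Bump⇒sum {zero}          record { at = () }
Bump⇒sum {suc m} {c} {r} b = begin
  sumℕ r                                ≡⟨ sum-remove r at ⟩
  r at + sumℕ (λ j → r (punchIn at j))  ≡⟨ cong₂ _+_ r-at (const⇒sum≡* (λ j → r-off _ (punchInᵢ≢i at j))) ⟩
  suc c + m * c                         ≡⟨ suc[m]*c+1≡ m c ⟨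
  suc m * c + 1                         ∎
  where open Bump b; open ≡-Reasoning

Bump⇒counts : ∀ {m c} {r : Fin m → ℕ} → Bump r c →
              count (λ j → r j ≡ᵇ c) + 1 ≡ m × count (λ j → r j ≡ᵇ suc c) ≡ 1
Bump⇒counts {zero}          record { at = () }
Bump⇒counts {suc m} {c} {r} b =
    trans (cong (_+ 1) (trans (count-remove-false (λ j → r j ≡ᵇ c) at (≡ᵇ-false (1+n≢n ∘ trans (≡.sym r-at))))
                              (const⇒count≡ rest≡c)))
          (+-comm m 1)
  , trans (count-remove (λ j → r j ≡ᵇ suc c) at)
          (cong₂ _+_ (cong 𝟙 (≡ᵇ-true r-at))
                     (count-none (λ j → ≡ᵇ-false (1+n≢n ∘ ≡.sym ∘ trans (≡.sym (rest≡c j))))))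
  where
  open Bump b
  rest≡c : ∀ j → r (punchIn at j) ≡ c
  rest≡c j = r-off _ (punchInᵢ≢i at j)

counts⇒Bump : ∀ {m c} {r : Fin m → ℕ} →
              count (λ j → r j ≡ᵇ c) + 1 ≡ m → count (λ j → r j ≡ᵇ suc c) ≡ 1 → Bump r c
counts⇒Bump {zero}          _  ()
counts⇒Bump {suc m} {c} {r} #c #suc-c =
  record { at = w ; r-at = r-w ; r-off = ∀-punchIn⇒∀-≢ w (count≡⇒const #rest) }
  where
  witness = count-witness (λ j → r j ≡ᵇ suc c) (subst (0 <_) (≡.sym #suc-c) z<s)
  w = proj₁ witness
  r-w : r w ≡ suc c
  r-w = ≡ᵇ-true⁻ (proj₂ witness)
  #rest : count (λ j → r (punchIn w j) ≡ᵇ c) ≡ m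
  #rest = +-cancelʳ-≡ 1 _ m (begin
    count (λ j → r (punchIn w j) ≡ᵇ c) + 1
      ≡⟨ cong (_+ 1) (count-remove-false (λ j → r j ≡ᵇ c) w (≡ᵇ-false (1+n≢n ∘ trans (≡.sym r-w)))) ⟨
    count (λ j → r j ≡ᵇ c) + 1              ≡⟨ #c ⟩
    suc m                                    ≡⟨ +-comm 1 m ⟩
    m + 1                                    ∎)
    where open ≡-Reasoning

-- Graphs: the handshake lemma, isomorphisms, complete and complete bipartite graphs

𝟙-adj : ∀ {n} (G : Graph n) i j → 𝟙 (adj G i j) ≡ 𝟙 (isEdge G i j) + 𝟙 (isEdge G j i)
𝟙-adj G i j rewrite Graph.sym G j i with <-cmp (toℕ i) (toℕ j)
... | tri< i<j _ j≮i rewrite <ᵇ-true i<j | <ᵇ-false j≮i = ≡.sym (+-identityʳ _)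
... | tri> i≮j _ j<i rewrite <ᵇ-false i≮j | <ᵇ-true j<i = refl
... | tri≈ i≮j i≡j j≮i rewrite <ᵇ-false i≮j | <ᵇ-false j≮i | toℕ-injective i≡j | irref G j = refl

adj⇒isEdge : ∀ {n} (G : Graph n) i j → adj G i j ≡ true → isEdge G i j ≡ true ⊎ isEdge G j i ≡ true
adj⇒isEdge G i j a with isEdge G i j | isEdge G j i | 𝟙-adj G i j
... | true  | _     | _     = inj₁ refl
... | false | true  | _     = inj₂ refl
... | false | false | 𝟙a≡0 = ⊥-elim (1+n≢0 (trans (cong 𝟙 (≡.sym a)) 𝟙a≡0))

isEdge⇒adj : ∀ {n} (G : Graph n) {i j} → isEdge G i j ≡ true → adj G i j ≡ true
isEdge⇒adj G {i} {j} = ∧-conicalʳ (toℕ i <ᵇ toℕ j) (adj G i j)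

handshake : ∀ {n} (G : Graph n) → sumℕ (deg G) ≡ 2 * numEdges G
handshake {n} G = begin
  sumℕ (λ i → count (adj G i))               ≡⟨ sum-cong (λ i → count≡sum𝟙 (adj G i)) ⟩
  sumℕ (λ i → sumℕ (λ j → 𝟙 (adj G i j)))    ≡⟨ sum-cong (λ i → sum-cong (𝟙-adj G i)) ⟩
  sumℕ (λ i → sumℕ (λ j → e i j + e j i))    ≡⟨ sum-cong (λ i → sum-+ (e i) (λ j → e j i)) ⟩
  sumℕ (λ i → sumℕ (e i) + sumℕ (λ j → e j i))
    ≡⟨ sum-+ (λ i → sumℕ (e i)) (λ i → sumℕ (λ j → e j i)) ⟩
  Σe + sumℕ (λ i → sumℕ (λ j → e j i))       ≡⟨ cong (Σe +_) (sum-comm e) ⟨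
  Σe + Σe                                    ≡⟨ cong (λ x → x + x) (sum-cong (λ i → count≡sum𝟙 (isEdge G i))) ⟨
  numEdges G + numEdges G                    ≡⟨ cong (numEdges G +_) (+-identityʳ _) ⟨
  2 * numEdges G                             ∎
  where
  open ≡-Reasoning
  e : Fin n → Fin n → ℕ
  e i j = 𝟙 (isEdge G i j)
  Σe : ℕ
  Σe = sumℕ (λ i → sumℕ (e i))

deg≡count-others : ∀ {m} (G : Graph (suc m)) v → deg G v ≡ count (λ j → adj G v (punchIn v j))
deg≡count-others G v = count-remove-false (adj G v) v (irref G v)

deg<n : ∀ {n} (G : Graph n) v → deg G v < n
deg<n {suc m} G v = s≤s (subst (_≤ m) (≡.sym (deg≡count-others G v)) (count≤n (λ j → adj G v (punchIn v j))))

module _ {n m} {G : Graph n} {H : Graph m} (I : Iso G H) where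
  open Iso I

  iso-size : n ≡ m
  iso-size = ↔⇒≡ (permutation to from to∘from from∘to)

  sum-iso : (f : Fin m → ℕ) → sumℕ (λ i → f (to i)) ≡ sumℕ f
  sum-iso f = begin
    sumℕ (λ i → f (to i))     ≡⟨ sumℕ≡∑ (λ i → f (to i)) ⟩
    ∑ℕ.sum (λ i → f (to i))   ≡⟨ ∑ℕ.∑-permute f (permutation to from to∘from from∘to) ⟨
    ∑ℕ.sum f                  ≡⟨ sumℕ≡∑ f ⟨
    sumℕ f                    ∎
    where open ≡-Reasoning

  deg-iso : ∀ i → deg G i ≡ deg H (to i)
  deg-iso i = begin
    count (adj G i)                   ≡⟨ count-cong (λ j → ≡.sym (adj-pres i j)) ⟩
    count (λ j → adj H (to i) (to j))  ≡⟨ count≡sum𝟙 (λ j → adj H (to i) (to j)) ⟩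
    sumℕ (λ j → 𝟙 (adj H (to i) (to j)))  ≡⟨ sum-iso (λ k → 𝟙 (adj H (to i) k)) ⟩
    sumℕ (λ k → 𝟙 (adj H (to i) k))       ≡⟨ count≡sum𝟙 (adj H (to i)) ⟨
    deg H (to i)                      ∎
    where open ≡-Reasoning

  numEdges-iso : numEdges G ≡ numEdges H
  numEdges-iso = *-cancelˡ-≡ _ _ 2 (begin
    2 * numEdges G            ≡⟨ handshake G ⟨
    sumℕ (deg G)              ≡⟨ sum-cong deg-iso ⟩
    sumℕ (λ i → deg H (to i)) ≡⟨ sum-iso (deg H) ⟩
    sumℕ (deg H)              ≡⟨ handshake H ⟩
    2 * numEdges H            ∎)
    where open ≡-Reasoning

iso-trans : ∀ {n m l} {G : Graph n} {H : Graph m} {J : Graph l} → Iso G H → Iso H J → Iso G J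
iso-trans I₁ I₂ = record
  { to       = λ i → I₂.to (I₁.to i)
  ; from     = λ x → I₁.from (I₂.from x)
  ; from∘to  = λ i → trans (cong I₁.from (I₂.from∘to (I₁.to i))) (I₁.from∘to i)
  ; to∘from  = λ x → trans (cong I₂.to (I₁.to∘from (I₂.from x))) (I₂.to∘from x)
  ; adj-pres = λ i j → trans (I₂.adj-pres (I₁.to i) (I₁.to j)) (I₁.adj-pres i j)
  }
  where
  module I₁ = Iso I₁
  module I₂ = Iso I₂

ExtremalPair : ℕ → ℕ → ℕ → ℕ → Set
ExtremalPair d D a b = (a ≡ d × b ≡ D) ⊎ (a ≡ D × b ≡ d)

extremalPair? : ∀ d D a b → Dec (ExtremalPair d D a b)
extremalPair? d D a b = ((a ℕ.≟ d) ×-dec (b ℕ.≟ D)) ⊎-dec ((a ℕ.≟ D) ×-dec (b ℕ.≟ d))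

ExtremalPair-sym : ∀ {d D a b} → ExtremalPair d D a b → ExtremalPair d D b a
ExtremalPair-sym (inj₁ (a≡d , b≡D)) = inj₂ (b≡D , a≡d)
ExtremalPair-sym (inj₂ (a≡D , b≡d)) = inj₁ (b≡d , a≡D)

⌊≟⌋-≢ : ∀ {n} {i j : Fin n} → i ≢ j → ⌊ i ≟ j ⌋ ≡ false
⌊≟⌋-≢ {i = i} {j} i≢j = trans (isYes≗does (i ≟ j)) (dec-false (i ≟ j) i≢j)

deg-K : ∀ {m} (i : Fin (suc m)) → deg (K (suc m)) i ≡ m
deg-K {m} i = trans (deg≡count-others (K (suc m)) i)
                    (count-all (λ j → cong not (⌊≟⌋-≢ (punchInᵢ≢i i j ∘ ≡.sym))))

2*numEdges-K : ∀ m → 2 * numEdges (K (suc m)) ≡ suc m * m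
2*numEdges-K m = trans (≡.sym (handshake (K (suc m)))) (const⇒sum≡* {suc m} deg-K)

adj-of-full-degree : ∀ {m} (G : Graph (suc m)) i → deg G i ≡ m → ∀ j → j ≢ i → adj G i j ≡ true
adj-of-full-degree G i deg≡m = ∀-punchIn⇒∀-≢ i (count≡n⇒all (trans (≡.sym (deg≡count-others G i)) deg≡m))

iso-K : ∀ {m} (G : Graph (suc m)) → (∀ i → deg G i ≡ m) → Iso G (K (suc m))
iso-K G deg≡m = record
  { to = λ i → i ; from = λ i → i ; from∘to = λ _ → refl ; to∘from = λ _ → refl
  ; adj-pres = adj≡ }
  where
  adj≡ : ∀ i j → not ⌊ i ≟ j ⌋ ≡ adj G i j
  adj≡ i j with i ≟ j
  ... | yes refl = ≡.sym (irref G i)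
  ... | no  i≢j  = ≡.sym (adj-of-full-degree G i (deg≡m i) j (i≢j ∘ ≡.sym))

iso-K₂-Kbip₁₁ : Iso (K 2) (Kbip 1 1)
iso-K₂-Kbip₁₁ = record
  { to = λ i → i ; from = λ i → i ; from∘to = λ _ → refl ; to∘from = λ _ → refl
  ; adj-pres = adj≡ }
  where
  adj≡ : ∀ i j → adj (Kbip 1 1) i j ≡ adj (K 2) i j
  adj≡ zero       zero       = refl
  adj≡ zero       (suc zero) = refl
  adj≡ (suc zero) zero       = refl
  adj≡ (suc zero) (suc zero) = refl

sum-↑ : ∀ a {b} (f : Fin (a + b) → ℕ) → sumℕ f ≡ sumℕ (λ i → f (i ↑ˡ b)) + sumℕ (λ j → f (a ↑ʳ j))
sum-↑ zero    f = refl
sum-↑ (suc a) f = trans (cong (f zero +_) (sum-↑ a (λ k → f (suc k)))) (≡.sym (+-assoc (f zero) _ _))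

module _ (a b : ℕ) where

  ↑ˡ-< : ∀ (i : Fin a) → toℕ (i ↑ˡ b) < a
  ↑ˡ-< i = subst (_< a) (≡.sym (toℕ-↑ˡ i b)) (toℕ<n i)

  ↑ʳ-≮ : ∀ (j : Fin b) → ¬ toℕ (a ↑ʳ j) < a
  ↑ʳ-≮ j lt = <⇒≱ lt (subst (a ≤_) (≡.sym (toℕ-↑ʳ a j)) (m≤m+n a (toℕ j)))

  count-< : count {a + b} (λ y → toℕ y <ᵇ a) ≡ a
  count-< = begin
    count {a + b} (λ y → toℕ y <ᵇ a)                               ≡⟨ count≡sum𝟙 {a + b} (λ y → toℕ y <ᵇ a) ⟩
    sumℕ {a + b} (λ y → 𝟙 (toℕ y <ᵇ a))                            ≡⟨ sum-↑ a {b} (λ y → 𝟙 (toℕ y <ᵇ a)) ⟩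
    sumℕ {a} (λ i → 𝟙 (toℕ (i ↑ˡ b) <ᵇ a)) + sumℕ {b} (λ j → 𝟙 (toℕ (a ↑ʳ j) <ᵇ a))
      ≡⟨ cong₂ _+_ (const⇒sum≡* {a} (λ i → cong 𝟙 (<ᵇ-true (↑ˡ-< i))))
                   (const⇒sum≡* {b} (λ j → cong 𝟙 (<ᵇ-false (↑ʳ-≮ j)))) ⟩
    a * 1 + b * 0                                                  ≡⟨ cong₂ _+_ (*-identityʳ a) (*-zeroʳ b) ⟩
    a + 0                                                          ≡⟨ +-identityʳ a ⟩
    a                                                              ∎
    where open ≡-Reasoning

  count-≮ : count {a + b} (λ y → not (toℕ y <ᵇ a)) ≡ b
  count-≮ = +-cancelˡ-≡ a #≮ b (trans (cong (_+ #≮) (≡.sym count-<)) (count-compl {a + b} (λ y → toℕ y <ᵇ a)))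
    where #≮ = count {a + b} (λ y → not (toℕ y <ᵇ a))

  deg-Kbip : ∀ x → deg (Kbip a b) x ≡ (if toℕ x <ᵇ a then b else a)
  deg-Kbip x with toℕ x <ᵇ a
  ... | true  = trans (count-cong {a + b} (λ y → let z = toℕ y <ᵇ a in
                                          trans (cong (not z ∨_) (∧-zeroʳ z)) (∨-identityʳ (not z))))
                      count-≮
  ... | false = trans (count-cong {a + b} (λ y → ∧-identityʳ (toℕ y <ᵇ a))) count-<

  2*numEdges-Kbip : 2 * numEdges (Kbip a b) ≡ a * b + b * a
  2*numEdges-Kbip = begin
    2 * numEdges (Kbip a b)      ≡⟨ handshake (Kbip a b) ⟨
    sumℕ (deg (Kbip a b))        ≡⟨ sum-↑ a (deg (Kbip a b)) ⟩
    sumℕ {a} (λ i → deg (Kbip a b) (i ↑ˡ b)) + sumℕ {b} (λ j → deg (Kbip a b) (a ↑ʳ j))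
      ≡⟨ cong₂ _+_ (const⇒sum≡* {a} (λ i → trans (deg-Kbip (i ↑ˡ b)) (cong (if_then b else a) (<ᵇ-true (↑ˡ-< i)))))
                   (const⇒sum≡* {b} (λ j → trans (deg-Kbip (a ↑ʳ j)) (cong (if_then b else a) (<ᵇ-false (↑ʳ-≮ j))))) ⟩
    a * b + b * a                ∎
    where open ≡-Reasoning

  numEdges-Kbip : numEdges (Kbip a b) ≡ a * b
  numEdges-Kbip = *-cancelˡ-≡ _ _ 2 (trans 2*numEdges-Kbip (cong (a * b +_) (trans (*-comm b a) (≡.sym (+-identityʳ _)))))

  deg-Kbip-side : ∀ z {u} → (toℕ z <ᵇ a) ≡ u → deg (Kbip a b) z ≡ (if u then b else a)
  deg-Kbip-side z refl = deg-Kbip z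

  private
    sides : ∀ p q → (p ∧ not q) ∨ (q ∧ not p) ≡ true → (p ≡ true × q ≡ false) ⊎ (p ≡ false × q ≡ true)
    sides true  false _ = inj₁ (refl , refl)
    sides false true  _ = inj₂ (refl , refl)

  Kbip-extremal : ∀ x y → adj (Kbip a b) x y ≡ true →
                  ExtremalPair a b (deg (Kbip a b) x) (deg (Kbip a b) y)
  Kbip-extremal x y e with sides (toℕ x <ᵇ a) (toℕ y <ᵇ a) e
  ... | inj₁ (x<a , y≮a) = inj₂ (deg-Kbip-side x x<a , deg-Kbip-side y y≮a)
  ... | inj₂ (x≮a , y<a) = inj₁ (deg-Kbip-side x x≮a , deg-Kbip-side y y<a)

isLeft : ∀ {A B : Set} → A ⊎ B → Bool
isLeft = [ (λ _ → true) , (λ _ → false) ]′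

record Partition {n} (p : Fin n → Bool) (a b : ℕ) : Set where
  field
    to        : Fin n → Fin a ⊎ Fin b
    from      : Fin a ⊎ Fin b → Fin n
    from∘to   : ∀ i → from (to i) ≡ i
    to∘from   : ∀ x → to (from x) ≡ x
    isLeft-to : ∀ i → isLeft (to i) ≡ p i

partition : ∀ {n} (p : Fin n → Bool) → ∃₂ (Partition p)
partition {zero} p = 0 , 0 , record
  { to = λ () ; from = λ { (inj₁ ()) ; (inj₂ ()) } ; from∘to = λ ()
  ; to∘from = λ { (inj₁ ()) ; (inj₂ ()) } ; isLeft-to = λ () }
partition {suc n} p with partition (λ i → p (suc i)) | p zero in p₀
... | a , b , P | true = suc a , b , record
  { to = to ; from = from ; from∘to = from∘to ; to∘from = to∘from ; isLeft-to = isLeft-to }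
  where
  module P = Partition P
  to : Fin (suc n) → Fin (suc a) ⊎ Fin b
  to zero    = inj₁ zero
  to (suc i) = map₁ suc (P.to i)
  from : Fin (suc a) ⊎ Fin b → Fin (suc n)
  from (inj₁ zero)    = zero
  from (inj₁ (suc x)) = suc (P.from (inj₁ x))
  from (inj₂ y)       = suc (P.from (inj₂ y))
  from-shift : ∀ s → from (map₁ suc s) ≡ suc (P.from s)
  from-shift (inj₁ _) = refl
  from-shift (inj₂ _) = refl
  from∘to : ∀ i → from (to i) ≡ i
  from∘to zero    = refl
  from∘to (suc i) = trans (from-shift (P.to i)) (cong suc (P.from∘to i))
  to∘from : ∀ x → to (from x) ≡ x
  to∘from (inj₁ zero)    = refl
  to∘from (inj₁ (suc x)) = cong (map₁ suc) (P.to∘from (inj₁ x))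
  to∘from (inj₂ y)       = cong (map₁ suc) (P.to∘from (inj₂ y))
  isLeft-shift : ∀ (s : Fin a ⊎ Fin b) → isLeft (map₁ suc s) ≡ isLeft s
  isLeft-shift (inj₁ _) = refl
  isLeft-shift (inj₂ _) = refl
  isLeft-to : ∀ i → isLeft (to i) ≡ p i
  isLeft-to zero    = ≡.sym p₀
  isLeft-to (suc i) = trans (isLeft-shift (P.to i)) (P.isLeft-to i)
... | a , b , P | false = a , suc b , record
  { to = to ; from = from ; from∘to = from∘to ; to∘from = to∘from ; isLeft-to = isLeft-to }
  where
  module P = Partition P
  to : Fin (suc n) → Fin a ⊎ Fin (suc b)
  to zero    = inj₂ zero
  to (suc i) = map₂ suc (P.to i)
  from : Fin a ⊎ Fin (suc b) → Fin (suc n)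
  from (inj₂ zero)    = zero
  from (inj₂ (suc y)) = suc (P.from (inj₂ y))
  from (inj₁ x)       = suc (P.from (inj₁ x))
  from-shift : ∀ s → from (map₂ suc s) ≡ suc (P.from s)
  from-shift (inj₁ _) = refl
  from-shift (inj₂ _) = refl
  from∘to : ∀ i → from (to i) ≡ i
  from∘to zero    = refl
  from∘to (suc i) = trans (from-shift (P.to i)) (cong suc (P.from∘to i))
  to∘from : ∀ x → to (from x) ≡ x
  to∘from (inj₂ zero)    = refl
  to∘from (inj₂ (suc y)) = cong (map₂ suc) (P.to∘from (inj₂ y))
  to∘from (inj₁ x)       = cong (map₂ suc) (P.to∘from (inj₁ x))
  isLeft-shift : ∀ (s : Fin a ⊎ Fin b) → isLeft (map₂ suc s) ≡ isLeft s
  isLeft-shift (inj₁ _) = refl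
  isLeft-shift (inj₂ _) = refl
  isLeft-to : ∀ i → isLeft (to i) ≡ p i
  isLeft-to zero    = ≡.sym p₀
  isLeft-to (suc i) = trans (isLeft-shift (P.to i)) (P.isLeft-to i)

join-<ᵇ : ∀ a b (s : Fin a ⊎ Fin b) → (toℕ (join a b s) <ᵇ a) ≡ isLeft s
join-<ᵇ a b (inj₁ x) = <ᵇ-true (↑ˡ-< a b x)
join-<ᵇ a b (inj₂ y) = <ᵇ-false (↑ʳ-≮ a b y)

iso-Kbip : ∀ {n a b} (G : Graph n) {p : Fin n → Bool} → Partition p a b →
           (∀ i j → adj G i j ≡ (p i ∧ not (p j)) ∨ (p j ∧ not (p i))) → Iso G (Kbip a b)
iso-Kbip {a = a} {b} G {p} P adj≡ = record
  { to       = λ i → join a b (P.to i)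
  ; from     = λ x → P.from (splitAt a x)
  ; from∘to  = λ i → trans (cong P.from (splitAt-join a b (P.to i))) (P.from∘to i)
  ; to∘from  = λ x → trans (cong (join a b) (P.to∘from (splitAt a x))) (join-splitAt a b x)
  ; adj-pres = λ i j → trans (cong₂ (λ x y → (x ∧ not y) ∨ (y ∧ not x)) (side i) (side j)) (≡.sym (adj≡ i j))
  }
  where
  module P = Partition P
  side : ∀ i → (toℕ (join a b (P.to i)) <ᵇ a) ≡ p i
  side i = trans (join-<ᵇ a b (P.to i)) (P.isLeft-to i)

module _ {δ Δ : ℕ} (0<δ : 0 < δ) (δ≤Δ : δ ≤ Δ) where

  private
    0<Δ : 0 < Δ
    0<Δ = ≤-trans 0<δ δ≤Δ
    between : ∀ u → δ ≤ (if u then Δ else δ) × (if u then Δ else δ) ≤ Δ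
    between true  = δ≤Δ , ≤-refl
    between false = ≤-refl , δ≤Δ

  minDeg-Kbip : MinDeg (Kbip δ Δ) δ
  minDeg-Kbip = (λ x → subst (δ ≤_) (≡.sym (deg-Kbip δ Δ x)) (proj₁ (between (toℕ x <ᵇ δ))))
              , δ ↑ʳ fromℕ< 0<Δ , deg-Kbip-side δ Δ _ (<ᵇ-false (↑ʳ-≮ δ Δ (fromℕ< 0<Δ)))

  maxDeg-Kbip : MaxDeg (Kbip δ Δ) Δ
  maxDeg-Kbip = (λ x → subst (_≤ Δ) (≡.sym (deg-Kbip δ Δ x)) (proj₂ (between (toℕ x <ᵇ δ))))
              , fromℕ< 0<δ ↑ˡ Δ , deg-Kbip-side δ Δ _ (<ᵇ-true (↑ˡ-< δ Δ (fromℕ< 0<δ)))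

  0<numEdges-Kbip : 0 < numEdges (Kbip δ Δ)
  0<numEdges-Kbip = subst (0 <_) (≡.sym (numEdges-Kbip δ Δ)) (*-mono-< 0<δ 0<Δ)

minDeg-K : ∀ Δ → MinDeg (K (suc Δ)) Δ
minDeg-K Δ = (λ i → ≤-reflexive (≡.sym (deg-K i))) , zero , deg-K zero

maxDeg-K : ∀ Δ → MaxDeg (K (suc Δ)) Δ
maxDeg-K Δ = (λ i → ≤-reflexive (deg-K i)) , zero , deg-K zero

0<numEdges-K : ∀ {Δ} → 0 < Δ → 0 < numEdges (K (suc Δ))
0<numEdges-K {Δ} 0<Δ = n≢0⇒n>0 (λ E≡0 →
  <⇒≢ (*-mono-< (s≤s (z≤n {Δ})) 0<Δ) (trans (cong (2 *_) (≡.sym E≡0)) (2*numEdges-K Δ)))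

-- Degree sequences: the lower bound and the family 𝒢_{δ,Δ}

n*[n+1]%2≡0 : ∀ n → n * (n + 1) % 2 ≡ 0
n*[n+1]%2≡0 zero    = refl
n*[n+1]%2≡0 (suc n) = begin
  suc n * (suc n + 1) % 2            ≡⟨ cong (_% 2) (step n) ⟩
  (n * (n + 1) + (n + 1) * 2) % 2    ≡⟨ [m+kn]%n≡m%n (n * (n + 1)) (n + 1) 2 ⟩
  n * (n + 1) % 2                    ≡⟨ n*[n+1]%2≡0 n ⟩
  0                                  ∎
  where
  open ≡-Reasoning
  step : ∀ n → suc n * (suc n + 1) ≡ n * (n + 1) + (n + 1) * 2
  step = solve-∀

n*n%2≡n%2 : ∀ n → n * n % 2 ≡ n % 2
n*n%2≡n%2 n with n % 2 | m%n<n n 2 | %-distribˡ-* n n 2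
... | 0           | _              | eq = eq
... | 1           | _              | eq = eq
... | suc (suc _) | s≤s (s≤s ())   | _

module DegreeSequence {m} (G : Graph (suc m)) {δ Δ : ℕ} (mn : MinDeg G δ) (mx : MaxDeg G Δ) where

  v : Fin (suc m)
  v = proj₁ (proj₂ mx)

  deg-v : deg G v ≡ Δ
  deg-v = proj₂ (proj₂ mx)

  rest : Fin m → ℕ
  rest j = deg G (punchIn v j)

  δ≤rest : ∀ j → δ ≤ rest j
  δ≤rest j = proj₁ mn (punchIn v j)

  Δ≤m : Δ ≤ m
  Δ≤m = s≤s⁻¹ (subst (_< suc m) deg-v (deg<n G v))

  2E≡Δ+Σrest : 2 * numEdges G ≡ Δ + sumℕ rest
  2E≡Δ+Σrest = trans (≡.sym (handshake G)) (trans (sum-remove (deg G) v) (cong (_+ sumℕ rest) deg-v))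

  numDeg≡ : ∀ d → numDeg G d ≡ 𝟙 (Δ ≡ᵇ d) + count (λ j → rest j ≡ᵇ d)
  numDeg≡ d = trans (count-remove (λ i → deg G i ≡ᵇ d) v)
                    (cong (λ x → 𝟙 (x ≡ᵇ d) + count (λ j → rest j ≡ᵇ d)) deg-v)

  private
    mδ≤Σrest : m * δ ≤ sumℕ rest
    mδ≤Σrest = subst (_≤ sumℕ rest) (sum-const {m} δ) (sum-mono δ≤rest)

    Δ[δ+1]≡ : Δ * (δ + 1) ≡ Δ + Δ * δ
    Δ[δ+1]≡ = trans (cong (Δ *_) (+-comm δ 1)) (*-suc Δ δ)

    Σrest≡ : ∀ {x} → 2 * numEdges G ≡ Δ * (δ + 1) + x → sumℕ rest ≡ Δ * δ + x
    Σrest≡ {x} 2E≡ = +-cancelˡ-≡ Δ _ _ (begin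
      Δ + sumℕ rest    ≡⟨ 2E≡Δ+Σrest ⟨
      2 * numEdges G   ≡⟨ 2E≡ ⟩
      Δ * (δ + 1) + x  ≡⟨ cong (_+ x) Δ[δ+1]≡ ⟩
      Δ + Δ * δ + x    ≡⟨ +-assoc Δ (Δ * δ) x ⟩
      Δ + (Δ * δ + x)  ∎)
      where open ≡-Reasoning

  Δ+mδ≤2E : Δ + m * δ ≤ 2 * numEdges G
  Δ+mδ≤2E = subst (Δ + m * δ ≤_) (≡.sym 2E≡Δ+Σrest) (+-monoʳ-≤ Δ mδ≤Σrest)

  Δ[δ+1]≤2E : Δ * (δ + 1) ≤ 2 * numEdges G
  Δ[δ+1]≤2E = begin
    Δ * (δ + 1)      ≡⟨ Δ[δ+1]≡ ⟩
    Δ + Δ * δ        ≤⟨ +-monoʳ-≤ Δ (*-monoˡ-≤ δ Δ≤m) ⟩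
    Δ + m * δ        ≤⟨ Δ+mδ≤2E ⟩
    2 * numEdges G   ∎
    where open ≤-Reasoning

  2E≡Δ[δ+1]⇒ : 0 < δ → 2 * numEdges G ≡ Δ * (δ + 1) → m ≡ Δ × (∀ j → rest j ≡ δ)
  2E≡Δ[δ+1]⇒ 0<δ 2E≡ = m≡Δ , sum≡*⇒const δ≤rest (trans Σrest≡Δδ (cong (_* δ) (≡.sym m≡Δ)))
    where
    Σrest≡Δδ : sumℕ rest ≡ Δ * δ
    Σrest≡Δδ = trans (Σrest≡ (trans 2E≡ (≡.sym (+-identityʳ _)))) (+-identityʳ _)
    m≡Δ : m ≡ Δ
    m≡Δ = ≤-antisym (*-cancelʳ-≤ m Δ δ {{>-nonZero 0<δ}} (subst (m * δ ≤_) Σrest≡Δδ mδ≤Σrest)) Δ≤m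

  ⇒2E≡Δ[δ+1] : m ≡ Δ → (∀ j → rest j ≡ δ) → 2 * numEdges G ≡ Δ * (δ + 1)
  ⇒2E≡Δ[δ+1] m≡Δ rest≡δ = begin
    2 * numEdges G  ≡⟨ 2E≡Δ+Σrest ⟩
    Δ + sumℕ rest   ≡⟨ cong (Δ +_) (trans (const⇒sum≡* rest≡δ) (cong (_* δ) m≡Δ)) ⟩
    Δ + Δ * δ       ≡⟨ Δ[δ+1]≡ ⟨
    Δ * (δ + 1)     ∎
    where open ≡-Reasoning

  2E≡Δ[δ+1]+1⇒ : 1 < δ → 2 * numEdges G ≡ Δ * (δ + 1) + 1 → m ≡ Δ × Bump rest δ
  2E≡Δ[δ+1]+1⇒ 1<δ 2E≡ = m≡Δ , sum≡*+1⇒Bump δ≤rest (trans (Σrest≡ 2E≡) (cong (λ x → x * δ + 1) (≡.sym m≡Δ)))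
    where
    m≤Δ : m ≤ Δ
    m≤Δ = ≮⇒≥ (λ Δ<m → <⇒≱ (begin-strict
      sumℕ rest        ≡⟨ Σrest≡ 2E≡ ⟩
      Δ * δ + 1        <⟨ +-monoʳ-< (Δ * δ) 1<δ ⟩
      Δ * δ + δ        ≡⟨ +-comm (Δ * δ) δ ⟩
      suc Δ * δ        ≤⟨ *-monoˡ-≤ δ Δ<m ⟩
      m * δ            ∎) mδ≤Σrest)
      where open ≤-Reasoning
    m≡Δ : m ≡ Δ
    m≡Δ = ≤-antisym m≤Δ Δ≤m

  ⇒2E≡Δ[δ+1]+1 : m ≡ Δ → Bump rest δ → 2 * numEdges G ≡ Δ * (δ + 1) + 1
  ⇒2E≡Δ[δ+1]+1 m≡Δ bump = begin
    2 * numEdges G   ≡⟨ 2E≡Δ+Σrest ⟩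
    Δ + sumℕ rest    ≡⟨ cong (Δ +_) (trans (Bump⇒sum bump) (cong (λ x → x * δ + 1) m≡Δ)) ⟩
    Δ + (Δ * δ + 1)  ≡⟨ +-assoc Δ (Δ * δ) 1 ⟨
    Δ + Δ * δ + 1    ≡⟨ cong (_+ 1) Δ[δ+1]≡ ⟨
    Δ * (δ + 1) + 1  ∎
    where open ≡-Reasoning

  regular : δ ≡ Δ → ∀ i → deg G i ≡ Δ
  regular δ≡Δ i = ≤-antisym (proj₁ mx i) (subst (_≤ deg G i) δ≡Δ (proj₁ mn i))

  2E≡Δ[δ+1]⇔K : 0 < δ → δ ≡ Δ → (2 * numEdges G ≡ Δ * (δ + 1) ⇔ Iso G (K (suc Δ)))
  2E≡Δ[δ+1]⇔K 0<δ δ≡Δ = mk⇔ to from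
    where
    to : 2 * numEdges G ≡ Δ * (δ + 1) → Iso G (K (suc Δ))
    to 2E≡ = subst (λ k → Iso G (K (suc k))) m≡Δ (iso-K G (λ i → trans (regular δ≡Δ i) (≡.sym m≡Δ)))
      where m≡Δ = proj₁ (2E≡Δ[δ+1]⇒ 0<δ 2E≡)
    from : Iso G (K (suc Δ)) → 2 * numEdges G ≡ Δ * (δ + 1)
    from I = ⇒2E≡Δ[δ+1] (suc-injective (iso-size I)) (λ j → trans (regular δ≡Δ (punchIn v j)) (≡.sym δ≡Δ))

  private
    numDeg-≢Δ : ∀ {d} → d ≢ Δ → numDeg G d ≡ count (λ j → rest j ≡ᵇ d)
    numDeg-≢Δ {d} d≢Δ = trans (numDeg≡ d) (cong (λ b → 𝟙 b + count (λ j → rest j ≡ᵇ d)) (≡ᵇ-false (d≢Δ ∘ ≡.sym)))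

    numDeg-Δ : numDeg G Δ ≡ suc (count (λ j → rest j ≡ᵇ Δ))
    numDeg-Δ = trans (numDeg≡ Δ) (cong (λ b → 𝟙 b + count (λ j → rest j ≡ᵇ Δ)) (≡ᵇ-true {Δ} refl))

    numDeg-δ⇔ : δ < Δ → m ≡ Δ → (numDeg G δ ≡ Δ ∸ 1 ⇔ count (λ j → rest j ≡ᵇ δ) + 1 ≡ m)
    numDeg-δ⇔ δ<Δ m≡Δ = mk⇔
      (λ #δ → trans (≡∸1⇒+1≡ (≤-trans z<s δ<Δ) (trans (≡.sym (numDeg-≢Δ (<⇒≢ δ<Δ))) #δ)) (≡.sym m≡Δ))
      (λ #rest → trans (numDeg-≢Δ (<⇒≢ δ<Δ)) (+1≡⇒≡∸1 (trans #rest m≡Δ)))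
      where
      +1≡⇒≡∸1 : ∀ {x y} → x + 1 ≡ y → x ≡ y ∸ 1
      +1≡⇒≡∸1 {x} refl = ≡.sym (m+n∸n≡m x 1)
      ≡∸1⇒+1≡ : ∀ {x y} → 0 < y → x ≡ y ∸ 1 → x + 1 ≡ y
      ≡∸1⇒+1≡ {y = suc y} _ refl = +-comm y 1

    Δ[δ+1]≡Δ*Δ : suc δ ≡ Δ → Δ * (δ + 1) ≡ Δ * Δ
    Δ[δ+1]≡Δ*Δ sδ≡Δ = cong (Δ *_) (trans (+-comm δ 1) sδ≡Δ)

  family-even : 0 < δ → δ ≤ Δ → Δ * (δ + 1) % 2 ≡ 0 →
                (2 * numEdges G ≡ Δ * (δ + 1) ⇔ InGfamily δ Δ G)
  family-even 0<δ δ≤Δ even = mk⇔ to from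
    where
    to : 2 * numEdges G ≡ Δ * (δ + 1) → InGfamily δ Δ G
    to 2E≡ with m≤n⇒m<n∨m≡n δ≤Δ | 2E≡Δ[δ+1]⇒ 0<δ 2E≡
    ... | inj₂ δ≡Δ | _              = inj₁ (δ≡Δ , Equivalence.to (2E≡Δ[δ+1]⇔K 0<δ δ≡Δ) 2E≡)
    ... | inj₁ δ<Δ | m≡Δ , rest≡δ =
      inj₂ (inj₁ (δ<Δ , even , cong suc m≡Δ , trans (numDeg-≢Δ (<⇒≢ δ<Δ)) (trans (const⇒count≡ rest≡δ) m≡Δ)))
    from : InGfamily δ Δ G → 2 * numEdges G ≡ Δ * (δ + 1)
    from (inj₁ (δ≡Δ , I)) = Equivalence.from (2E≡Δ[δ+1]⇔K 0<δ δ≡Δ) I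
    from (inj₂ (inj₁ (δ<Δ , _ , n≡ , #δ))) =
      ⇒2E≡Δ[δ+1] m≡Δ (count≡⇒const (trans (≡.sym (numDeg-≢Δ (<⇒≢ δ<Δ))) (trans #δ (≡.sym m≡Δ))))
      where m≡Δ = suc-injective n≡
    from (inj₂ (inj₂ (inj₁ (_ , odd , _)))) = ⊥-elim (0≢1+n (trans (≡.sym even) odd))
    from (inj₂ (inj₂ (inj₂ (sδ≡Δ , Δodd , _)))) =
      ⊥-elim (0≢1+n (trans (≡.sym even) (trans (cong (_% 2) (Δ[δ+1]≡Δ*Δ sδ≡Δ)) (trans (n*n%2≡n%2 Δ) Δodd))))

  private
    ⇒InGfamily-odd : 1 < δ → δ < Δ → Δ * (δ + 1) % 2 ≡ 1 → 2 * numEdges G ≡ Δ * (δ + 1) + 1 → InGfamily δ Δ G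
    ⇒InGfamily-odd 1<δ δ<Δ odd 2E≡ with 2E≡Δ[δ+1]+1⇒ 1<δ 2E≡ | m≤n⇒m<n∨m≡n δ<Δ
    ... | m≡Δ , bump | inj₁ sδ<Δ =
      inj₂ (inj₂ (inj₁ (sδ<Δ , odd , cong suc m≡Δ , Equivalence.from (numDeg-δ⇔ δ<Δ m≡Δ) (proj₁ (Bump⇒counts bump))
                       , trans (numDeg-≢Δ (<⇒≢ sδ<Δ)) (proj₂ (Bump⇒counts bump)))))
    ... | m≡Δ , bump | inj₂ sδ≡Δ =
      inj₂ (inj₂ (inj₂ (sδ≡Δ , Δodd , cong suc m≡Δ , Equivalence.from (numDeg-δ⇔ δ<Δ m≡Δ) (proj₁ (Bump⇒counts bump))
                       , trans numDeg-Δ (cong suc (subst (λ d → count (λ j → rest j ≡ᵇ d) ≡ 1) sδ≡Δ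
                                                         (proj₂ (Bump⇒counts bump)))))))
      where Δodd = trans (≡.sym (n*n%2≡n%2 Δ)) (trans (cong (_% 2) (≡.sym (Δ[δ+1]≡Δ*Δ sδ≡Δ))) odd)

    InGfamily⇒-odd : δ < Δ → Δ * (δ + 1) % 2 ≡ 1 → InGfamily δ Δ G → 2 * numEdges G ≡ Δ * (δ + 1) + 1
    InGfamily⇒-odd δ<Δ odd (inj₁ (δ≡Δ , _)) = ⊥-elim (<⇒≢ δ<Δ δ≡Δ)
    InGfamily⇒-odd δ<Δ odd (inj₂ (inj₁ (_ , even , _))) = ⊥-elim (0≢1+n (trans (≡.sym even) odd))
    InGfamily⇒-odd δ<Δ odd (inj₂ (inj₂ (inj₁ (sδ<Δ , _ , n≡ , #δ , #sδ)))) =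
      ⇒2E≡Δ[δ+1]+1 m≡Δ (counts⇒Bump (Equivalence.to (numDeg-δ⇔ δ<Δ m≡Δ) #δ)
                                    (trans (≡.sym (numDeg-≢Δ (<⇒≢ sδ<Δ))) #sδ))
      where m≡Δ = suc-injective n≡
    InGfamily⇒-odd δ<Δ odd (inj₂ (inj₂ (inj₂ (sδ≡Δ , _ , n≡ , #δ , #Δ)))) =
      ⇒2E≡Δ[δ+1]+1 m≡Δ (counts⇒Bump (Equivalence.to (numDeg-δ⇔ δ<Δ m≡Δ) #δ)
                                    (subst (λ d → count (λ j → rest j ≡ᵇ d) ≡ 1) (≡.sym sδ≡Δ)
                                           (suc-injective (trans (≡.sym numDeg-Δ) #Δ))))
      where m≡Δ = suc-injective n≡

  family-odd : 0 < δ → δ ≤ Δ → Δ * (δ + 1) % 2 ≡ 1 →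
               (2 * numEdges G ≡ Δ * (δ + 1) + 1 ⇔ InGfamily δ Δ G)
  family-odd 0<δ δ≤Δ odd = mk⇔ (⇒InGfamily-odd 1<δ δ<Δ odd) (InGfamily⇒-odd δ<Δ odd)
    where
    δ<Δ : δ < Δ
    δ<Δ = ≤∧≢⇒< δ≤Δ (λ δ≡Δ → 0≢1+n (trans (≡.sym (n*[n+1]%2≡0 Δ))
                                          (subst (λ x → Δ * (x + 1) % 2 ≡ 1) δ≡Δ odd)))
    1<δ : 1 < δ
    1<δ = ≤∧≢⇒< 0<δ (λ 1≡δ → 0≢1+n (trans (≡.sym (m*n%n≡0 Δ 2))
                                          (subst (λ x → Δ * (x + 1) % 2 ≡ 1) (≡.sym 1≡δ) odd)))

-- The GA term of an edge is smallest when its end degrees are δ and Δ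

isqrt-spec : ∀ m → isqrt m * isqrt m ≤ m × m < suc (isqrt m) * suc (isqrt m)
isqrt-spec zero    = z≤n , s≤s z≤n
isqrt-spec (suc m) with isqrt m | isqrt-spec m
... | r | r²≤m , m<[r+1]² with suc r * suc r ≤ᵇ suc m in step
...   | true  = ≤ᵇ⇒≤ (suc r * suc r) (suc m) (subst T (≡.sym step) _)
              , ≤-<-trans m<[r+1]² (*-mono-< (n<1+n (suc r)) (n<1+n (suc r)))
...   | false = ≤-trans r²≤m (n≤1+n m)
              , ≰⇒> (λ le → subst T step (≤⇒≤ᵇ le))

square-≤⇒≤ : ∀ {x y} → x * x ≤ y * y → x ≤ y
square-≤⇒≤ x²≤y² = ≮⇒≥ (λ y<x → <⇒≱ (*-mono-< y<x y<x) x²≤y²)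

square-<⇒< : ∀ {x y} → x * x < y * y → x < y
square-<⇒< x²<y² = ≰⇒> (λ y≤x → <⇒≱ x²<y² (*-mono-≤ y≤x y≤x))

≤-isqrt : ∀ {r m} → r * r ≤ m → r ≤ isqrt m
≤-isqrt {r} {m} r²≤m = s≤s⁻¹ (square-<⇒< (≤-<-trans r²≤m (proj₂ (isqrt-spec m))))

isqrt-≤ : ∀ {r m} → m ≤ r * r → isqrt m ≤ r
isqrt-≤ {r} {m} m≤r² = square-≤⇒≤ (≤-trans (proj₁ (isqrt-spec m)) m≤r²)

square-gap : ∀ {u w X L m} → u ≤ L * X → suc (2 * L) * m ≤ X → u * u + X * X < w * w → u + m ≤ w
square-gap {u} {w} {X} {L} {m} u≤LX [2L+1]m≤X u²+X²<w² = ≮⇒≥ (λ w<u+m → <⇒≱ u²+X²<w² (begin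
  w * w                        ≤⟨ *-mono-≤ (<⇒≤ w<u+m) (<⇒≤ w<u+m) ⟩
  (u + m) * (u + m)            ≡⟨ expand u m ⟩
  u * u + m * (2 * u + m)      ≤⟨ +-monoʳ-≤ (u * u) (*-monoʳ-≤ m (+-mono-≤ (*-monoʳ-≤ 2 u≤LX) m≤X)) ⟩
  u * u + m * (2 * (L * X) + X) ≡⟨ cong (u * u +_) (regroup m L X) ⟩
  u * u + suc (2 * L) * m * X  ≤⟨ +-monoʳ-≤ (u * u) (*-monoˡ-≤ X [2L+1]m≤X) ⟩
  u * u + X * X                ∎))
  where
  open ≤-Reasoning
  m≤X : m ≤ X
  m≤X = ≤-trans (m≤m+n m (2 * L * m)) [2L+1]m≤X
  expand : ∀ u m → (u + m) * (u + m) ≡ u * u + m * (2 * u + m)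
  expand = solve-∀
  regroup : ∀ m L X → m * (2 * (L * X) + X) ≡ suc (2 * L) * m * X
  regroup = solve-∀

rearrangement-gap : ∀ {p q r s} → q ≤ p → s ≤ r → p * s + q * r + (p ∸ q) * (r ∸ s) ≡ p * r + q * s
rearrangement-gap {p} {q} {r} {s} q≤p s≤r =
  subst₂ (λ P R → P * s + q * R + (p ∸ q) * (r ∸ s) ≡ P * R + q * s)
         (m+[n∸m]≡n q≤p) (m+[n∸m]≡n s≤r) (identity q (p ∸ q) s (r ∸ s))
  where
  identity : ∀ q u s w → (q + u) * s + q * (s + w) + u * w ≡ (q + u) * (s + w) + q * s
  identity = solve-∀

*-squeeze : ∀ {d D x y} → 0 < d → 0 < D → d ≤ x → y ≤ D → x * D ≤ y * d → x ≡ d × y ≡ D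
*-squeeze {d} {D} {x} {y} 0<d 0<D d≤x y≤D xD≤yd =
    *-cancelʳ-≡ x d D {{>-nonZero 0<D}} (≤-antisym (≤-trans xD≤yd yd≤dD) dD≤xD)
  , *-cancelʳ-≡ y D d {{>-nonZero 0<d}}
                 (≤-antisym (*-monoˡ-≤ d y≤D) (≤-trans (≤-trans (≤-reflexive (*-comm D d)) dD≤xD) xD≤yd))
  where
  dD≤xD : d * D ≤ x * D
  dD≤xD = *-monoˡ-≤ D d≤x
  yd≤dD : y * d ≤ d * D
  yd≤dD = subst (y * d ≤_) (*-comm D d) (*-monoˡ-≤ d y≤D)

module _ {d D a b : ℕ} (d≤a : d ≤ a) (a≤D : a ≤ D) (d≤b : d ≤ b) (b≤D : b ≤ D) where

  private
    bd≤aD : b * d ≤ a * D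
    bd≤aD = subst (b * d ≤_) (*-comm D a) (*-mono-≤ b≤D d≤a)
    ad≤bD : a * d ≤ b * D
    ad≤bD = subst (a * d ≤_) (*-comm D b) (*-mono-≤ a≤D d≤b)

  -- The squared form of 2√(dD)/(d+D) ≤ 2√(ab)/(a+b), with its exact gap.
  ga-square-gap : d * D * ((a + b) * (a + b)) + (a * D ∸ b * d) * (b * D ∸ a * d) ≡ a * b * ((d + D) * (d + D))
  ga-square-gap = begin
    d * D * ((a + b) * (a + b)) + g                        ≡⟨ expand-left d D a b g ⟩
    (a * D) * (a * d) + (b * d) * (b * D) + g + 2 * (a * b * d * D)
      ≡⟨ cong (_+ 2 * (a * b * d * D)) (rearrangement-gap bd≤aD ad≤bD) ⟩
    (a * D) * (b * D) + (b * d) * (a * d) + 2 * (a * b * d * D) ≡⟨ expand-right d D a b ⟨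
    a * b * ((d + D) * (d + D))                            ∎
    where
    open ≡-Reasoning
    g = (a * D ∸ b * d) * (b * D ∸ a * d)
    expand-left : ∀ d D a b g → d * D * ((a + b) * (a + b)) + g ≡
                  (a * D) * (a * d) + (b * d) * (b * D) + g + 2 * (a * b * d * D)
    expand-left = solve-∀
    expand-right : ∀ d D a b → a * b * ((d + D) * (d + D)) ≡
                   (a * D) * (b * D) + (b * d) * (a * d) + 2 * (a * b * d * D)
    expand-right = solve-∀

  non-extremal⇒gap>0 : 0 < d → ¬ ExtremalPair d D a b → 0 < (a * D ∸ b * d) * (b * D ∸ a * d)
  non-extremal⇒gap>0 0<d non-extremal = *-mono-< {0} {_} {0} (m<n⇒0<n∸m bd<aD) (m<n⇒0<n∸m ad<bD)
    where
    0<D = ≤-trans 0<d (≤-trans d≤a a≤D)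
    bd<aD : b * d < a * D
    bd<aD = ≰⇒> (λ aD≤bd → non-extremal (inj₁ (*-squeeze 0<d 0<D d≤a b≤D aD≤bd)))
    ad<bD : a * d < b * D
    ad<bD = ≰⇒> (λ bD≤ad → non-extremal (inj₂ (swap (*-squeeze 0<d 0<D d≤b a≤D bD≤ad))))

-- For Y = 4 ^ (k + 1), s / ((a + b) * 2 ^ k) is the k-th approximation of the GA term of an edge
-- with end degrees a and b, and t / (c * 2 ^ k) that of an edge with end degrees δ and Δ.
module GATermBounds {δ Δ : ℕ} (0<δ : 0 < δ) (δ≤Δ : δ ≤ Δ) (Y : ℕ) {a b : ℕ}
                    (δ≤a : δ ≤ a) (a≤Δ : a ≤ Δ) (δ≤b : δ ≤ b) (b≤Δ : b ≤ Δ) where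

  c t s gap : ℕ
  c = δ + Δ
  t = isqrt (Y * δ * Δ)
  s = isqrt (Y * a * b)
  gap = (a * Δ ∸ b * δ) * (b * Δ ∸ a * δ)

  private
    instance
      c*c≢0 : NonZero (c * c)
      c*c≢0 = >-nonZero (*-mono-< (≤-trans 0<δ (m≤m+n δ Δ)) (≤-trans 0<δ (m≤m+n δ Δ)))

  squares : t * (a + b) * (t * (a + b)) + Y * gap < suc s * c * (suc s * c)
  squares = begin-strict
    t * (a + b) * (t * (a + b)) + Y * gap          ≡⟨ cong (_+ Y * gap) (interchange t (a + b)) ⟩
    t * t * ((a + b) * (a + b)) + Y * gap
      ≤⟨ +-monoˡ-≤ (Y * gap) (*-monoˡ-≤ ((a + b) * (a + b)) (proj₁ (isqrt-spec (Y * δ * Δ)))) ⟩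
    Y * δ * Δ * ((a + b) * (a + b)) + Y * gap      ≡⟨ factor Y δ Δ ((a + b) * (a + b)) gap ⟩
    Y * (δ * Δ * ((a + b) * (a + b)) + gap)        ≡⟨ cong (Y *_) (ga-square-gap δ≤a a≤Δ δ≤b b≤Δ) ⟩
    Y * (a * b * (c * c))                          ≡⟨ assoc Y a b (c * c) ⟩
    Y * a * b * (c * c)                            <⟨ *-monoˡ-< (c * c) (proj₂ (isqrt-spec (Y * a * b))) ⟩
    suc s * suc s * (c * c)                        ≡⟨ interchange (suc s) c ⟨
    suc s * c * (suc s * c)                        ∎
    where
    open ≤-Reasoning
    interchange : ∀ x y → x * y * (x * y) ≡ x * x * (y * y)
    interchange = solve-∀
    factor : ∀ Y δ Δ z g → Y * δ * Δ * z + Y * g ≡ Y * (δ * Δ * z + g)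
    factor = solve-∀
    assoc : ∀ Y a b z → Y * (a * b * z) ≡ Y * a * b * z
    assoc = solve-∀

  lower-bound : (t ∸ c) * (a + b) ≤ s * c
  lower-bound = begin
    (t ∸ c) * (a + b)              ≡⟨ *-distribʳ-∸ (a + b) t c ⟩
    t * (a + b) ∸ c * (a + b)      ≤⟨ ∸-monoʳ-≤ (t * (a + b)) (m≤m*n c (a + b) {{>-nonZero 0<a+b}}) ⟩
    t * (a + b) ∸ c                ≤⟨ m≤n+o⇒m∸n≤o (t * (a + b)) c (<⇒≤ u<w) ⟩
    s * c                          ∎
    where
    open ≤-Reasoning
    0<a+b = ≤-trans 0<δ (≤-trans δ≤a (m≤m+n a b))
    u<w : t * (a + b) < suc s * c
    u<w = square-<⇒< (≤-<-trans (m≤m+n _ (Y * gap)) squares)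

  lower-bound-strict : ¬ ExtremalPair δ Δ a b → ∀ {X} M → Y ≡ X * X →
                       suc (2 * (2 * Δ * Δ)) * (2 * Δ * M + c) ≤ X →
                       (t ∸ c + M) * (a + b) ≤ s * c
  lower-bound-strict non-extremal {X} M Y≡X² X-large = begin
    (t ∸ c + M) * (a + b)          ≤⟨ *-monoˡ-≤ (a + b) (+-monoˡ-≤ M (m∸n≤m t c)) ⟩
    (t + M) * (a + b)              ≡⟨ *-distribʳ-+ (a + b) t M ⟩
    t * (a + b) + M * (a + b)
      ≤⟨ +-monoʳ-≤ (t * (a + b)) (≤-trans (*-monoʳ-≤ M (+-mono-≤ a≤Δ b≤Δ)) (≤-reflexive (twice M Δ))) ⟩
    t * (a + b) + 2 * Δ * M        ≤⟨ +-cancelʳ-≤ c _ _ u+m≤w ⟩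
    s * c                          ∎
    where
    open ≤-Reasoning
    twice : ∀ M Δ → M * (Δ + Δ) ≡ 2 * Δ * M
    twice = solve-∀
    t≤XΔ : t ≤ X * Δ
    t≤XΔ = isqrt-≤ (begin
      Y * δ * Δ        ≡⟨ cong (λ y → y * δ * Δ) Y≡X² ⟩
      X * X * δ * Δ    ≤⟨ *-monoˡ-≤ Δ (*-monoʳ-≤ (X * X) δ≤Δ) ⟩
      X * X * Δ * Δ    ≡⟨ square X Δ ⟩
      X * Δ * (X * Δ)  ∎)
      where square : ∀ X Δ → X * X * Δ * Δ ≡ X * Δ * (X * Δ)
            square = solve-∀
    u≤LX : t * (a + b) ≤ 2 * Δ * Δ * X
    u≤LX = ≤-trans (*-mono-≤ t≤XΔ (+-mono-≤ a≤Δ b≤Δ)) (≤-reflexive (regroup X Δ))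
      where regroup : ∀ X Δ → X * Δ * (Δ + Δ) ≡ 2 * Δ * Δ * X
            regroup = solve-∀
    u+m≤w : t * (a + b) + 2 * Δ * M + c ≤ s * c + c
    u+m≤w = subst₂ _≤_ (≡.sym (+-assoc (t * (a + b)) (2 * Δ * M) c)) (+-comm c (s * c))
                       (square-gap {L = 2 * Δ * Δ} u≤LX X-large (begin-strict
      t * (a + b) * (t * (a + b)) + X * X   ≡⟨ cong (t * (a + b) * (t * (a + b)) +_) (≡.sym Y≡X²) ⟩
      t * (a + b) * (t * (a + b)) + Y
        ≤⟨ +-monoʳ-≤ _ (m≤m*n Y gap {{>-nonZero (non-extremal⇒gap>0 δ≤a a≤Δ δ≤b b≤Δ 0<δ non-extremal)}}) ⟩
      t * (a + b) * (t * (a + b)) + Y * gap <⟨ squares ⟩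
      suc s * c * (suc s * c)               ∎))

-- Dyadic approximations of GA₁ and the comparison with extremal graphs

-- ratio a d is a / (1 + d).
ratio : ℕ → ℕ → ℚᵘ
ratio a d = mkℚᵘ (ℤ.+ a) d

/≡ratio : ∀ a D .{{_ : NonZero D}} → (ℤ.+ a) Q./ D ≡ ratio a (pred D)
/≡ratio a (suc d) = refl

ratio-mono : ∀ {a b d e} → a * suc e ≤ b * suc d → ratio a d Q.≤ ratio b e
ratio-mono {a} {b} {d} {e} le = Q.*≤* (subst₂ ℤ._≤_ (ℤₚ.pos-* a (suc e)) (ℤₚ.pos-* b (suc d)) (ℤ.+≤+ le))

ratio-mono⁻ : ∀ {a b d} → ratio a d Q.≤ ratio b d → a ≤ b
ratio-mono⁻ {a} {b} {d} (Q.*≤* le) =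
  *-cancelʳ-≤ a b (suc d) (ℤₚ.drop‿+≤+ (subst₂ ℤ._≤_ (≡.sym (ℤₚ.pos-* a (suc d))) (≡.sym (ℤₚ.pos-* b (suc d))) le))

ratio-+ : ∀ a b d → ratio a d Q.+ ratio b d Q.≃ ratio (a + b) d
ratio-+ a b d = Q.*≡* (begin
  (ℤ.+ a ℤ.* ℤ.+ suc d ℤ.+ ℤ.+ b ℤ.* ℤ.+ suc d) ℤ.* ℤ.+ suc d  ≡⟨ identity (ℤ.+ a) (ℤ.+ b) (ℤ.+ suc d) ⟩
  (ℤ.+ a ℤ.+ ℤ.+ b) ℤ.* (ℤ.+ suc d ℤ.* ℤ.+ suc d)               ≡⟨ cong₂ ℤ._*_ (ℤₚ.pos-+ a b) (ℤₚ.pos-* (suc d) (suc d)) ⟨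
  ℤ.+ (a + b) ℤ.* ℤ.+ (suc d * suc d)                           ∎)
  where
  open ≡-Reasoning
  identity : ∀ x y z → (x ℤ.* z ℤ.+ y ℤ.* z) ℤ.* z ≡ (x ℤ.+ y) ℤ.* (z ℤ.* z)
  identity = ℤ-Solver.solve-∀

sumQ-ratio : ∀ {n} (h : Fin n → ℕ) d → sumQ (λ i → ratio (h i) d) Q.≃ ratio (sumℕ h) d
sumQ-ratio {zero}  h d = Q.*≡* refl
sumQ-ratio {suc n} h d = Qₚ.≃-trans (Qₚ.+-cong (Qₚ.≃-refl {ratio (h zero) d}) (sumQ-ratio (λ i → h (suc i)) d))
                                    (ratio-+ (h zero) (sumℕ (λ i → h (suc i))) d)

sumQ-mono : ∀ {n} {f g : Fin n → ℚᵘ} → (∀ i → f i Q.≤ g i) → sumQ f Q.≤ sumQ g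
sumQ-mono {zero}  f≤g = Qₚ.≤-refl
sumQ-mono {suc n} f≤g = Qₚ.+-mono-≤ (f≤g zero) (sumQ-mono (λ i → f≤g (suc i)))

sumQ-ratio-≤ : ∀ {n} (h : Fin n → ℕ) {f : Fin n → ℚᵘ} d → (∀ i → ratio (h i) d Q.≤ f i) → ratio (sumℕ h) d Q.≤ sumQ f
sumQ-ratio-≤ h d h≤f = Qₚ.≤-respˡ-≃ (sumQ-ratio h d) (sumQ-mono h≤f)

sumQ-≤-ratio : ∀ {n} (h : Fin n → ℕ) {f : Fin n → ℚᵘ} d → (∀ i → f i Q.≤ ratio (h i) d) → sumQ f Q.≤ ratio (sumℕ h) d
sumQ-≤-ratio h d f≤h = Qₚ.≤-respʳ-≃ (sumQ-ratio h d) (sumQ-mono f≤h)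

edgeSum : ∀ {n} → Graph n → (Fin n → Fin n → ℕ) → ℕ
edgeSum G f = sumℕ (λ i → sumℕ (λ j → if isEdge G i j then f i j else 0))

module _ {n} (G : Graph n) where

  edgeSum-const : ∀ x → edgeSum G (λ _ _ → x) ≡ x * numEdges G
  edgeSum-const x = begin
    sumℕ (λ i → sumℕ (λ j → if isEdge G i j then x else 0))  ≡⟨ sum-cong (λ i → sum-cong (λ j → 𝟙-scale (isEdge G i j))) ⟩
    sumℕ (λ i → sumℕ (λ j → e i j * x))                       ≡⟨ sum-cong (λ i → sum-*ʳ (e i) x) ⟩
    sumℕ (λ i → sumℕ (e i) * x)                               ≡⟨ sum-*ʳ (λ i → sumℕ (e i)) x ⟩
    sumℕ (λ i → sumℕ (e i)) * x                               ≡⟨ cong (_* x) (sum-cong (λ i → count≡sum𝟙 (isEdge G i))) ⟨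
    numEdges G * x                                            ≡⟨ *-comm (numEdges G) x ⟩
    x * numEdges G                                            ∎
    where
    open ≡-Reasoning
    e : Fin n → Fin n → ℕ
    e i j = 𝟙 (isEdge G i j)
    𝟙-scale : ∀ b → (if b then x else 0) ≡ 𝟙 b * x
    𝟙-scale true  = ≡.sym (+-identityʳ x)
    𝟙-scale false = refl

  edgeSum-+ : ∀ f g → edgeSum G (λ i j → f i j + g i j) ≡ edgeSum G f + edgeSum G g
  edgeSum-+ f g = trans (sum-cong (λ i → trans (sum-cong (λ j → split (isEdge G i j))) (sum-+ (F i) (H i))))
                        (sum-+ (λ i → sumℕ (F i)) (λ i → sumℕ (H i)))
    where
    F = λ i j → if isEdge G i j then f i j else 0
    H = λ i j → if isEdge G i j then g i j else 0
    split : ∀ {x y} e → (if e then x + y else 0) ≡ (if e then x else 0) + (if e then y else 0)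
    split true  = refl
    split false = refl

  term≤edgeSum : ∀ f i j → isEdge G i j ≡ true → f i j ≤ edgeSum G f
  term≤edgeSum f i j e = ≤-trans (≤-reflexive (cong (if_then f i j else 0) (≡.sym e)))
    (≤-trans (term≤sum (λ j → if isEdge G i j then f i j else 0) j)
             (term≤sum (λ i → sumℕ (λ j → if isEdge G i j then f i j else 0)) i))

  module _ (k : ℕ) (d : ℕ) where

    ratio-edgeSum-≤-GAapprox : (ℓ : Fin n → Fin n → ℕ) →
      (∀ i j → isEdge G i j ≡ true → ratio (ℓ i j) d Q.≤ gaTermApprox k (deg G i) (deg G j)) →
      ratio (edgeSum G ℓ) d Q.≤ GAapprox k G
    ratio-edgeSum-≤-GAapprox ℓ ℓ≤term = sumQ-ratio-≤ _ d (λ i → sumQ-ratio-≤ _ d (λ j → on-edge i j))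
      where
      on-edge : ∀ i j → ratio (if isEdge G i j then ℓ i j else 0) d Q.≤
                        (if isEdge G i j then gaTermApprox k (deg G i) (deg G j) else 0ℚᵘ)
      on-edge i j with isEdge G i j in e
      ... | true  = ℓ≤term i j e
      ... | false = Q.*≤* (ℤ.+≤+ z≤n)

    GAapprox-≤-ratio : (u : ℕ) →
      (∀ i j → isEdge G i j ≡ true → gaTermApprox k (deg G i) (deg G j) Q.≤ ratio u d) →
      GAapprox k G Q.≤ ratio (u * numEdges G) d
    GAapprox-≤-ratio u term≤u = subst (λ x → GAapprox k G Q.≤ ratio x d) (edgeSum-const u)
      (sumQ-≤-ratio _ d (λ i → sumQ-≤-ratio _ d (λ j → on-edge i j)))
      where
      on-edge : ∀ i j → (if isEdge G i j then gaTermApprox k (deg G i) (deg G j) else 0ℚᵘ) Q.≤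
                        ratio (if isEdge G i j then u else 0) d
      on-edge i j with isEdge G i j in e
      ... | true  = term≤u i j e
      ... | false = Q.*≤* (ℤ.+≤+ z≤n)

gaTermApprox≡ratio : ∀ k a b → 0 < a + b →
                     gaTermApprox k a b ≡ ratio (isqrt (4 ^ suc k * a * b)) (pred ((a + b) * 2 ^ k))
gaTermApprox≡ratio k a b 0<a+b with a + b | 0<a+b
... | suc s | _ = /≡ratio (isqrt (4 ^ suc k * a * b)) (suc s * 2 ^ k) {{m*n≢0 (suc s) (2 ^ k) {{_}} {{m^n≢0 2 k}}}}

module _ (k : ℕ) {c : ℕ} (0<c : 0 < c) where

  private
    P d : ℕ
    P = 2 ^ k
    d = pred (c * P)
    instance
      P≢0 : NonZero P
      P≢0 = m^n≢0 2 k
    suc-d : suc d ≡ c * P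
    suc-d = suc-pred (c * P) {{m*n≢0 c P {{>-nonZero 0<c}}}}
    suc-pred-[a+b]P : ∀ {a b} → 0 < a + b → suc (pred ((a + b) * P)) ≡ (a + b) * P
    suc-pred-[a+b]P {a} {b} 0<a+b = suc-pred ((a + b) * P) {{m*n≢0 (a + b) P {{>-nonZero 0<a+b}}}}
    scale : ∀ {x y z w} → x * y ≤ z * w → x * (y * P) ≤ z * (w * P)
    scale {x} {y} {z} {w} le = subst₂ _≤_ (*-assoc x y P) (*-assoc z w P) (*-monoˡ-≤ P le)

  ratio-≤-gaTerm : ∀ {a b ℓ} → 0 < a + b → ℓ * (a + b) ≤ isqrt (4 ^ suc k * a * b) * c →
                   ratio ℓ d Q.≤ gaTermApprox k a b
  ratio-≤-gaTerm {a} {b} {ℓ} 0<a+b le rewrite gaTermApprox≡ratio k a b 0<a+b =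
    ratio-mono (subst₂ _≤_ (cong (ℓ *_) (≡.sym (suc-pred-[a+b]P {a} {b} 0<a+b))) (cong (s *_) (≡.sym suc-d))
                           (scale {ℓ} {a + b} {s} {c} le))
    where s = isqrt (4 ^ suc k * a * b)

  gaTerm-≤-ratio : ∀ {a b u} → 0 < a + b → isqrt (4 ^ suc k * a * b) * c ≤ u * (a + b) →
                   gaTermApprox k a b Q.≤ ratio u d
  gaTerm-≤-ratio {a} {b} {u} 0<a+b le rewrite gaTermApprox≡ratio k a b 0<a+b =
    ratio-mono (subst₂ _≤_ (cong (s *_) (≡.sym suc-d)) (cong (u *_) (≡.sym (suc-pred-[a+b]P {a} {b} 0<a+b)))
                           (scale {s} {c} {u} {a + b} le))
    where s = isqrt (4 ^ suc k * a * b)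

  /2^k≤ratio : ∀ x → (ℤ.+ x) Q./ P Q.≤ ratio (c * x) d
  /2^k≤ratio x = subst (Q._≤ ratio (c * x) d) (≡.sym (/≡ratio x P)) (ratio-mono (≤-reflexive (begin
    x * suc d            ≡⟨ cong (x *_) suc-d ⟩
    x * (c * P)          ≡⟨ regroup x c P ⟩
    c * x * P            ≡⟨ cong (c * x *_) (suc-pred P) ⟨
    c * x * suc (pred P) ∎)))
    where
    open ≡-Reasoning
    regroup : ∀ x c P → x * (c * P) ≡ c * x * P
    regroup = solve-∀

4^n≡2^n*2^n : ∀ n → 4 ^ n ≡ 2 ^ n * 2 ^ n
4^n≡2^n*2^n zero    = refl
4^n≡2^n*2^n (suc n) = trans (cong (4 *_) (4^n≡2^n*2^n n)) (regroup (2 ^ n))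
  where regroup : ∀ x → 4 * (x * x) ≡ 2 * x * (2 * x)
        regroup = solve-∀

n<2^n : ∀ n → n < 2 ^ n
n<2^n zero    = z<s
n<2^n (suc n) = subst₂ _≤_ (+-comm (suc n) 1) (cong (2 ^ n +_) (≡.sym (+-identityʳ (2 ^ n))))
                       (+-mono-≤ (n<2^n n) (m^n>0 2 n))

module Comparison {n m} {G : Graph n} {Γ : Graph m} {δ Δ : ℕ} (0<δ : 0 < δ) (δ≤Δ : δ ≤ Δ)
                  (mn : MinDeg G δ) (mx : MaxDeg G Δ)
                  (Γ-extremal : ∀ i j → isEdge Γ i j ≡ true → ExtremalPair δ Δ (deg Γ i) (deg Γ j))
                  (GA-G≤Γ : GA≤ G Γ) where

  private
    c E F : ℕ
    c = δ + Δ
    0<c : 0 < c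
    0<c = ≤-trans 0<δ (m≤m+n δ Δ)
    0<Δ : 0 < Δ
    0<Δ = ≤-trans 0<δ δ≤Δ
    E = numEdges G
    F = numEdges Γ

    extremal-term≤ : ∀ k {a b} → ExtremalPair δ Δ a b →
                     gaTermApprox k a b Q.≤ ratio (isqrt (4 ^ suc k * δ * Δ)) (pred (c * 2 ^ k))
    extremal-term≤ k (inj₁ (refl , refl)) = gaTerm-≤-ratio k 0<c 0<c ≤-refl
    extremal-term≤ k (inj₂ (refl , refl)) = gaTerm-≤-ratio k 0<c (subst (0 <_) (+-comm δ Δ) 0<c)
      (≤-reflexive (cong₂ _*_ (cong isqrt (swap-last (4 ^ suc k) Δ δ)) (+-comm δ Δ)))
      where swap-last : ∀ y a b → y * a * b ≡ y * b * a
            swap-last = solve-∀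

  edgeSum-bound : ∀ k (ℓ : Fin n → Fin n → ℕ) →
    (∀ i j → isEdge G i j ≡ true → ℓ i j * (deg G i + deg G j) ≤ isqrt (4 ^ suc k * deg G i * deg G j) * c) →
    edgeSum G ℓ ≤ (isqrt (4 ^ suc k * δ * Δ) + c) * F
  edgeSum-bound k ℓ ℓ-ok = ratio-mono⁻ (begin
    ratio (edgeSum G ℓ) d
      ≤⟨ ratio-edgeSum-≤-GAapprox G k d ℓ (λ i j e → ratio-≤-gaTerm k 0<c (0<deg+deg i j) (ℓ-ok i j e)) ⟩
    GAapprox k G                           ≤⟨ GA-G≤Γ k ⟩
    GAapprox k Γ Q.+ (ℤ.+ F) Q./ 2 ^ k
      ≤⟨ Qₚ.+-mono-≤ (GAapprox-≤-ratio Γ k d t (λ i j e → extremal-term≤ k (Γ-extremal i j e))) (/2^k≤ratio k 0<c F) ⟩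
    ratio (t * F) d Q.+ ratio (c * F) d    ≃⟨ ratio-+ (t * F) (c * F) d ⟩
    ratio (t * F + c * F) d                ≡⟨ cong (λ x → ratio x d) (*-distribʳ-+ F t c) ⟨
    ratio ((t + c) * F) d                  ∎)
    where
    open Qₚ.≤-Reasoning
    instance
      2^k≢0 : NonZero (2 ^ k)
      2^k≢0 = m^n≢0 2 k
    t = isqrt (4 ^ suc k * δ * Δ)
    d = pred (c * 2 ^ k)
    0<deg+deg : ∀ i j → 0 < deg G i + deg G j
    0<deg+deg i j = ≤-trans 0<δ (≤-trans (proj₁ mn i) (m≤m+n _ _))

  -- At precision R the slack τ and the bonus M of a non-extremal edge both exceed the total
  -- rounding error 2 * c * |E(Γ)| (in units of 1 / (c * 2 ^ R)).
  private
    M R X t τ : ℕ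
    M = suc (2 * c * F)
    R = suc (2 * (2 * Δ * Δ)) * (2 * Δ * M + c)
    X = 2 ^ suc R
    t = isqrt (4 ^ suc R * δ * Δ)
    τ = t ∸ c

    bonus : Fin n → Fin n → ℕ
    bonus i j = if does (extremalPair? δ Δ (deg G i) (deg G j)) then 0 else M

    bonus-non-extremal : ∀ i j → ¬ ExtremalPair δ Δ (deg G i) (deg G j) → bonus i j ≡ M
    bonus-non-extremal i j ¬ext = cong (λ b → if b then 0 else M) (dec-false (extremalPair? δ Δ (deg G i) (deg G j)) ¬ext)

    R≤X : R ≤ X
    R≤X = ≤-trans (<⇒≤ (n<2^n R)) (m≤m+n (2 ^ R) (2 ^ R + 0))

    M+c≤t : M + c ≤ t
    M+c≤t = begin
      M + c          ≤⟨ +-monoˡ-≤ c (m≤n*m M (2 * Δ) {{>-nonZero (*-monoʳ-< 2 0<Δ)}}) ⟩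
      2 * Δ * M + c  ≤⟨ m≤n*m (2 * Δ * M + c) (suc (2 * (2 * Δ * Δ))) ⟩
      R              ≤⟨ R≤X ⟩
      X              ≤⟨ ≤-isqrt (subst (_≤ 4 ^ suc R * δ * Δ) (4^n≡2^n*2^n (suc R)) Y≤YδΔ) ⟩
      t              ∎
      where
      open ≤-Reasoning
      Y≤YδΔ : 4 ^ suc R ≤ 4 ^ suc R * δ * Δ
      Y≤YδΔ = ≤-trans (m≤m*n (4 ^ suc R) δ {{>-nonZero 0<δ}}) (m≤m*n (4 ^ suc R * δ) Δ {{>-nonZero 0<Δ}})

    M≤τ : M ≤ τ
    M≤τ = m+n≤o⇒m≤o∸n M M+c≤t

    per-edge : ∀ i j → isEdge G i j ≡ true →
               (τ + bonus i j) * (deg G i + deg G j) ≤ isqrt (4 ^ suc R * deg G i * deg G j) * c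
    per-edge i j _ = on-pair (extremalPair? δ Δ (deg G i) (deg G j))
      where
      module B = GATermBounds 0<δ δ≤Δ (4 ^ suc R) (proj₁ mn i) (proj₁ mx i) (proj₁ mn j) (proj₁ mx j)
      on-pair : (ext? : Dec (ExtremalPair δ Δ (deg G i) (deg G j))) →
                (τ + (if does ext? then 0 else M)) * (deg G i + deg G j) ≤ B.s * c
      on-pair (yes _)    = subst (λ x → x * (deg G i + deg G j) ≤ B.s * c) (≡.sym (+-identityʳ τ)) B.lower-bound
      on-pair (no ¬ext) = B.lower-bound-strict ¬ext M (4^n≡2^n*2^n (suc R)) R≤X

    key : τ * E + edgeSum G bonus ≤ τ * F + 2 * c * F
    key = begin
      τ * E + edgeSum G bonus                  ≡⟨ cong (_+ edgeSum G bonus) (edgeSum-const G τ) ⟨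
      edgeSum G (λ _ _ → τ) + edgeSum G bonus  ≡⟨ edgeSum-+ G (λ _ _ → τ) bonus ⟨
      edgeSum G (λ i j → τ + bonus i j)        ≤⟨ edgeSum-bound R (λ i j → τ + bonus i j) per-edge ⟩
      (t + c) * F                              ≡⟨ cong (λ x → (x + c) * F) (≡.sym (m∸n+n≡m c≤t)) ⟩
      (τ + c + c) * F                          ≡⟨ regroup τ c F ⟩
      τ * F + 2 * c * F                        ∎
      where
      open ≤-Reasoning
      c≤t = ≤-trans (m≤n+m c M) M+c≤t
      regroup : ∀ τ c F → (τ + c + c) * F ≡ τ * F + 2 * c * F
      regroup = solve-∀

  numEdges-≤ : numEdges G ≤ numEdges Γ
  numEdges-≤ = ≮⇒≥ (λ F<E → <⇒≱ (<-≤-trans (n<1+n (2 * c * F)) M≤τ) (τ≤2cF F<E))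
    where
    open ≤-Reasoning
    τ≤2cF : F < E → τ ≤ 2 * c * F
    τ≤2cF F<E = +-cancelˡ-≤ (τ * F) τ (2 * c * F) (begin
      τ * F + τ                ≡⟨ +-comm (τ * F) τ ⟩
      τ + τ * F                ≡⟨ *-suc τ F ⟨
      τ * suc F                ≤⟨ *-monoʳ-≤ τ F<E ⟩
      τ * E                    ≤⟨ m≤m+n (τ * E) (edgeSum G bonus) ⟩
      τ * E + edgeSum G bonus  ≤⟨ key ⟩
      τ * F + 2 * c * F        ∎)

  extremal-of-numEdges≡ : numEdges G ≡ numEdges Γ →
                          ∀ i j → isEdge G i j ≡ true → ExtremalPair δ Δ (deg G i) (deg G j)
  extremal-of-numEdges≡ E≡F i j e with extremalPair? δ Δ (deg G i) (deg G j)
  ... | yes ext = ext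
  ... | no ¬ext = ⊥-elim (<⇒≱ (n<1+n (2 * c * F)) M≤2cF)
    where
    open ≤-Reasoning
    M≤2cF : M ≤ 2 * c * F
    M≤2cF = +-cancelˡ-≤ (τ * F) M (2 * c * F) (begin
      τ * F + M                ≡⟨ cong (λ x → τ * x + M) E≡F ⟨
      τ * E + M                ≤⟨ +-monoʳ-≤ (τ * E) (subst (_≤ edgeSum G bonus) (bonus-non-extremal i j ¬ext)
                                                          (term≤edgeSum G bonus i j e)) ⟩
      τ * E + edgeSum G bonus  ≤⟨ key ⟩
      τ * F + 2 * c * F        ∎)

-- The upper bound and K_{δ,Δ}

module _ {n} (G : Graph n) {δ Δ : ℕ} (0<δ : 0 < δ) (δ<Δ : δ < Δ) (mn : MinDeg G δ) (mx : MaxDeg G Δ)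
         (extremal : ∀ i j → adj G i j ≡ true → ExtremalPair δ Δ (deg G i) (deg G j))
         (E≡Δδ : numEdges G ≡ Δ * δ) where

  private
    p : Fin n → Bool
    p i = deg G i ≡ᵇ Δ

    v w : Fin n
    v = proj₁ (proj₂ mx)
    w = proj₁ (proj₂ mn)

    p-δ : ∀ {i} → deg G i ≡ δ → p i ≡ false
    p-δ deg≡δ = ≡ᵇ-false (<⇒≢ (subst (_< Δ) (≡.sym deg≡δ) δ<Δ))

    p-v : p v ≡ true
    p-v = ≡ᵇ-true (proj₂ (proj₂ mx))

    p-w : p w ≡ false
    p-w = p-δ (proj₂ (proj₂ mn))

    other-side : ∀ i j → adj G i j ≡ true → p j ≡ not (p i)
    other-side i j a with extremal i j a
    ... | inj₁ (i≡δ , j≡Δ) = trans (≡ᵇ-true j≡Δ) (cong not (≡.sym (p-δ i≡δ)))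
    ... | inj₂ (i≡Δ , j≡δ) = trans (p-δ j≡δ) (cong not (≡.sym (≡ᵇ-true i≡Δ)))

    across-from-Δ : ∀ {i} → p i ≡ true → ∀ j → adj G i j ≡ true → not (p j) ≡ true
    across-from-Δ {i} pi j a = cong not (trans (other-side i j a) (cong not pi))

    across-from-δ : ∀ {i} → p i ≡ false → ∀ j → adj G i j ≡ true → p j ≡ true
    across-from-δ {i} pi j a = trans (other-side i j a) (cong not pi)

    deg-by-side : ∀ i → deg G i ≡ (if p i then Δ else δ)
    deg-by-side i with count-witness (adj G i) (≤-trans 0<δ (proj₁ mn i))
    ... | j , a with extremal i j a
    ...   | inj₁ (i≡δ , _) rewrite p-δ i≡δ = i≡δ
    ...   | inj₂ (i≡Δ , _) rewrite ≡ᵇ-true i≡Δ = i≡Δ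

    #p #¬p : ℕ
    #p = count p
    #¬p = count (λ i → not (p i))

    Δ≤#¬p : Δ ≤ #¬p
    Δ≤#¬p = subst (_≤ #¬p) (proj₂ (proj₂ mx)) (count-mono (across-from-Δ p-v))

    δ≤#p : δ ≤ #p
    δ≤#p = subst (_≤ #p) (proj₂ (proj₂ mn)) (count-mono (across-from-δ p-w))

    #¬p≡Δ : #¬p ≡ Δ
    #¬p≡Δ = *-cancelʳ-≡ #¬p Δ δ {{>-nonZero 0<δ}}
              (proj₂ (+-squeeze (*-monoˡ-≤ Δ δ≤#p) (*-monoˡ-≤ δ Δ≤#¬p) (≤-reflexive (begin
      #p * Δ + #¬p * δ                      ≡⟨ sum-if p Δ δ ⟨
      sumℕ (λ i → if p i then Δ else δ)     ≡⟨ sum-cong deg-by-side ⟨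
      sumℕ (deg G)                          ≡⟨ handshake G ⟩
      2 * numEdges G                        ≡⟨ cong (2 *_) E≡Δδ ⟩
      2 * (Δ * δ)                           ≡⟨ double Δ δ ⟩
      δ * Δ + Δ * δ                         ∎))))
      where
      open ≡-Reasoning
      double : ∀ Δ δ → 2 * (Δ * δ) ≡ δ * Δ + Δ * δ
      double = solve-∀

    complete : ∀ i j → p i ≡ true → p j ≡ false → adj G i j ≡ true
    complete i j pi pj = count-squeeze {p = adj G i} {q = λ k → not (p k)} (across-from-Δ pi)
      (≤-reflexive (trans #¬p≡Δ (≡.sym (trans (deg-by-side i) (cong (if_then Δ else δ) pi)))))
      j (cong not pj)

    same-side : ∀ i j → p j ≡ p i → adj G i j ≡ false
    same-side i j pj≡pi with adj G i j in a
    ... | false = refl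
    ... | true  = ⊥-elim (not-¬ pj≡pi (other-side i j a))

    adj≡ : ∀ i j → adj G i j ≡ (p i ∧ not (p j)) ∨ (p j ∧ not (p i))
    adj≡ i j with p i in pi | p j in pj
    ... | true  | false = complete i j pi pj
    ... | false | true  = trans (Graph.sym G i j) (complete j i pj pi)
    ... | true  | true  = same-side i j (trans pj (≡.sym pi))
    ... | false | false = same-side i j (trans pj (≡.sym pi))

  iso-Kbip-of-extremal : Iso G (Kbip δ Δ)
  iso-Kbip-of-extremal = subst₂ (λ a b → Iso G (Kbip a b)) a≡δ b≡Δ I
    where
    a b : ℕ
    a = proj₁ (partition p)
    b = proj₁ (proj₂ (partition p))
    P : Partition p a b
    P = proj₂ (proj₂ (partition p))
    I : Iso G (Kbip a b)
    I = iso-Kbip G P adj≡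
    deg-by-part : ∀ i → deg G i ≡ (if p i then b else a)
    deg-by-part i = trans (deg-iso I i)
      (deg-Kbip-side a b (join a b (Partition.to P i)) (trans (join-<ᵇ a b (Partition.to P i)) (Partition.isLeft-to P i)))
    a≡δ : a ≡ δ
    a≡δ = trans (≡.sym (trans (deg-by-part w) (cong (if_then b else a) p-w))) (proj₂ (proj₂ mn))
    b≡Δ : b ≡ Δ
    b≡Δ = trans (≡.sym (trans (deg-by-part v) (cong (if_then b else a) p-v))) (proj₂ (proj₂ mx))

iso-Kbip₁₁-of-matching : ∀ {m} (G : Graph (suc m)) → (∀ i → deg G i ≡ 1) → numEdges G ≡ 1 → Iso G (Kbip 1 1)
iso-Kbip₁₁-of-matching {m} G deg≡1 E≡1 =
  iso-trans (subst (λ k → Iso G (K (suc k))) m≡1 (iso-K G (λ i → trans (deg≡1 i) (≡.sym m≡1)))) iso-K₂-Kbip₁₁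
  where
  m≡1 : m ≡ 1
  m≡1 = suc-injective (begin
    suc m               ≡⟨ *-identityʳ (suc m) ⟨
    suc m * 1           ≡⟨ const⇒sum≡* deg≡1 ⟨
    sumℕ (deg G)        ≡⟨ handshake G ⟩
    2 * numEdges G      ≡⟨ cong (2 *_) E≡1 ⟩
    2                   ∎)
    where open ≡-Reasoning

module _ {m δ Δ : ℕ} (G : Graph (suc m)) (0<δ : 0 < δ) (δ≡Δ : δ ≡ Δ) (mn : MinDeg G δ) (mx : MaxDeg G Δ)
         (minimal : Minimal δ Δ G) where

  iso-Kbip-of-regular-extremal : numEdges G ≡ Δ * δ → Iso G (Kbip δ Δ)
  iso-Kbip-of-regular-extremal E≡Δδ =
    subst₂ (λ a b → Iso G (Kbip a b)) (≡.sym δ≡1) (≡.sym Δ≡1)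
           (iso-Kbip₁₁-of-matching G (λ i → trans (≤-antisym (proj₁ mx i) (subst (_≤ deg G i) δ≡Δ (proj₁ mn i))) Δ≡1)
                                     (trans E≡Δδ (cong₂ _*_ Δ≡1 δ≡1)))
    where
    0<Δ : 0 < Δ
    0<Δ = subst (0 <_) δ≡Δ 0<δ
    module vsK = Comparison {G = G} {Γ = K (suc Δ)} 0<δ (≤-reflexive δ≡Δ) mn mx
                   (λ i j _ → inj₁ (trans (deg-K i) (≡.sym δ≡Δ) , deg-K j))
                   (minimal (suc Δ) (K (suc Δ)) (0<numEdges-K 0<Δ)
                            (subst (MinDeg (K (suc Δ))) (≡.sym δ≡Δ) (minDeg-K Δ)) (maxDeg-K Δ))
    Δ≤1 : Δ ≤ 1
    Δ≤1 = *-cancelʳ-≤ Δ 1 Δ {{>-nonZero 0<Δ}} (+-cancelʳ-≤ (Δ * Δ) (Δ * Δ) (1 * Δ) (begin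
      Δ * Δ + Δ * Δ              ≡⟨ cong (Δ * Δ +_) (+-identityʳ (Δ * Δ)) ⟨
      2 * (Δ * Δ)                ≡⟨ cong (λ x → 2 * (Δ * x)) δ≡Δ ⟨
      2 * (Δ * δ)                ≡⟨ cong (2 *_) E≡Δδ ⟨
      2 * numEdges G             ≤⟨ *-monoʳ-≤ 2 vsK.numEdges-≤ ⟩
      2 * numEdges (K (suc Δ))   ≡⟨ 2*numEdges-K Δ ⟩
      suc Δ * Δ                  ≡⟨ cong (_+ Δ * Δ) (*-identityˡ Δ) ⟨
      1 * Δ + Δ * Δ              ∎))
      where open ≤-Reasoning
    Δ≡1 : Δ ≡ 1
    Δ≡1 = ≤-antisym Δ≤1 0<Δ
    δ≡1 : δ ≡ 1
    δ≡1 = trans δ≡Δ Δ≡1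

module UpperBound {m δ Δ : ℕ} (G : Graph (suc m)) (0<δ : 0 < δ) (δ≤Δ : δ ≤ Δ)
                  (mn : MinDeg G δ) (mx : MaxDeg G Δ) (minimal : Minimal δ Δ G) where

  private
    module vsKbip = Comparison {G = G} {Γ = Kbip δ Δ} 0<δ δ≤Δ mn mx
                      (λ i j e → Kbip-extremal δ Δ i j (isEdge⇒adj (Kbip δ Δ) e))
                      (minimal (δ + Δ) (Kbip δ Δ) (0<numEdges-Kbip 0<δ δ≤Δ) (minDeg-Kbip 0<δ δ≤Δ) (maxDeg-Kbip 0<δ δ≤Δ))

    numEdges-Kbip′ : numEdges (Kbip δ Δ) ≡ Δ * δ
    numEdges-Kbip′ = trans (numEdges-Kbip δ Δ) (*-comm δ Δ)

  numEdges≤Δδ : numEdges G ≤ Δ * δ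
  numEdges≤Δδ = subst (numEdges G ≤_) numEdges-Kbip′ vsKbip.numEdges-≤

  numEdges≡Δδ⇔Kbip : numEdges G ≡ Δ * δ ⇔ Iso G (Kbip δ Δ)
  numEdges≡Δδ⇔Kbip = mk⇔ to (λ I → trans (numEdges-iso I) numEdges-Kbip′)
    where
    to : numEdges G ≡ Δ * δ → Iso G (Kbip δ Δ)
    to E≡Δδ with m≤n⇒m<n∨m≡n δ≤Δ
    ... | inj₂ δ≡Δ = iso-Kbip-of-regular-extremal G 0<δ δ≡Δ mn mx minimal E≡Δδ
    ... | inj₁ δ<Δ = iso-Kbip-of-extremal G 0<δ δ<Δ mn mx extremal E≡Δδ
      where
      E≡Kbip = trans E≡Δδ (≡.sym numEdges-Kbip′)
      extremal : ∀ i j → adj G i j ≡ true → ExtremalPair δ Δ (deg G i) (deg G j)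
      extremal i j a with adj⇒isEdge G i j a
      ... | inj₁ e = vsKbip.extremal-of-numEdges≡ E≡Kbip i j e
      ... | inj₂ e = ExtremalPair-sym (vsKbip.extremal-of-numEdges≡ E≡Kbip j i e)

odd≤2*⇒+1≤ : ∀ {x y} → x % 2 ≡ 1 → x ≤ 2 * y → x + 1 ≤ 2 * y
odd≤2*⇒+1≤ {x} {y} odd x≤2y = subst (_≤ 2 * y) (+-comm 1 x) (≤∧≢⇒< x≤2y x≢2y)
  where
  x≢2y : x ≢ 2 * y
  x≢2y refl = 0≢1+n (trans (≡.sym (m*n%n≡0 y 2)) (trans (cong (_% 2) (*-comm y 2)) odd))

vertex-bound : ∀ {δ Δ m} → 0 < δ → Δ + m * δ ≤ 2 * (Δ * δ) → δ * suc m ≤ Δ * (2 * δ ∸ 1) + δ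
vertex-bound {suc d} {Δ} {m} _ Δ+mδ≤2Δδ = +-cancelʳ-≤ Δ _ _ (begin
  suc d * suc m + Δ                  ≡⟨ reorder d m Δ ⟩
  Δ + m * suc d + suc d              ≤⟨ +-monoˡ-≤ (suc d) Δ+mδ≤2Δδ ⟩
  2 * (Δ * suc d) + suc d            ≡⟨ split Δ d ⟩
  Δ * (2 * suc d ∸ 1) + suc d + Δ    ∎)
  where
  open ≤-Reasoning
  reorder : ∀ d m Δ → suc d * suc m + Δ ≡ Δ + m * suc d + suc d
  reorder = solve-∀
  split : ∀ Δ d → 2 * (Δ * suc d) + suc d ≡ Δ * (d + suc (d + 0)) + suc d + Δ
  split = solve-∀

proposition2p8 : (δ Δ : ℕ) → 0 < δ → δ ≤ Δ →
    (n : ℕ) (G : Graph n) → MinDeg G δ → MaxDeg G Δ → Minimal δ Δ G →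
      (Δ * (δ + 1) % 2 ≡ 0 → Δ * (δ + 1) ≤ 2 * numEdges G)
    × (Δ * (δ + 1) % 2 ≡ 1 → Δ * (δ + 1) + 1 ≤ 2 * numEdges G)
    × numEdges G ≤ Δ * δ
    × suc Δ ≤ n
    × δ * n ≤ Δ * (2 * δ ∸ 1) + δ
    × (Δ * (δ + 1) % 2 ≡ 0 → (2 * numEdges G ≡ Δ * (δ + 1) ⇔ InGfamily δ Δ G))
    × (Δ * (δ + 1) % 2 ≡ 1 → (2 * numEdges G ≡ Δ * (δ + 1) + 1 ⇔ InGfamily δ Δ G))
    × (numEdges G ≡ Δ * δ ⇔ Iso G (Kbip δ Δ))
proposition2p8 δ Δ 0<δ δ≤Δ zero    G (_ , () , _) _ _
proposition2p8 δ Δ 0<δ δ≤Δ (suc m) G mn mx minimal =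
    (λ _ → Δ[δ+1]≤2E)
  , (λ odd → odd≤2*⇒+1≤ {y = numEdges G} odd Δ[δ+1]≤2E)
  , numEdges≤Δδ
  , s≤s Δ≤m
  , vertex-bound 0<δ (≤-trans Δ+mδ≤2E (*-monoʳ-≤ 2 numEdges≤Δδ))
  , family-even 0<δ δ≤Δ
  , family-odd 0<δ δ≤Δ
  , numEdges≡Δδ⇔Kbip
  where
  open DegreeSequence G mn mx
  open UpperBound G 0<δ δ≤Δ mn mx minimal
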